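{- Let $k$ be a positive real number. A graded poset $P$ is $k$-Eulerian if and only if for every interval $[x,y]\subseteq P$ of positive even rank $m=\rho(x,y)$, $$L^{k,m}_{[1,m-1]}([x,y])=\sum_{T\subseteq[1,m-1]}\left(-\frac1{2k}\right)^{|T|}f_T([x,y])=0.$$
   Context: A graded poset is a finite poset with unique minimum $\hat 0$, unique maximum $\hat 1$, and a rank function $\rho$ with $\rho(\hat0)=0$ and $\rho(y)-\rho(x)=1$ when $y$ covers $x$; $\rho(x,y)=\rho(y)-\rho(x)$, and an interval $[x,y]$ is a graded poset of rank $\rho(x,y)$. For a graded poset $Q$ of rank $m$ and $T\subseteq[1,m-1]$, $f_T(Q)$ is the number of chains in $Q$ whose set of ranks is exactly $T$. For $S\subseteq[1,m-1]$, $L^{k,m}_S(Q)=(-1)^{m-1-|S|}\sum_{T\supseteq[1,m-1]\setminus S}(-\frac1{2k})^{|T|}f_T(Q)$. The $k$-Möbius function: $\mu_k([x,x])=1$ and, for $x<y$, $\mu_k([x,y])=-1-\frac1k\sum_{x<z<y}\mu_k([x,z])$; $P$ is $k$-Eulerian if $\mu_k([x,y])=(-1)^{\rho(x,y)}$ for all intervals $[x,y]$. -}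

module Defs where

open import Level using (Level; _⊔_) renaming (suc to lsuc)
open import Data.Bool using (Bool; true; false; _∧_; _∨_; not; if_then_else_)
open import Data.Nat using (ℕ; zero; suc; _∸_; _≡ᵇ_)
open import Data.Fin using (Fin; toℕ)
open import Data.Vec using (Vec; []; _∷_; lookup)
open import Data.List using (List; []; _∷_; _++_; map; allFin; foldr)
open import Data.Bool.ListAction using (all; any)
open import Data.Sum using (_⊎_)
open import Data.Product using (_×_)
open import Relation.Nullary using (¬_)
open import Relation.Nullary.Decidable using (⌊_⌋)
open import Relation.Binary using (Rel; Decidable; IsPartialOrder; IsStrictTotalOrder)
open import Relation.Binary.PropositionalEquality using (_≡_)
open import Algebra.Bundles using (CommutativeRing)

module _ {c ℓ : Level} (R : CommutativeRing c ℓ) where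
  open CommutativeRing R

  record IsOrderedField (ℓ' : Level) : Set (c ⊔ ℓ ⊔ lsuc ℓ') where
    field
      _<_                : Rel Carrier ℓ'
      isStrictTotalOrder : IsStrictTotalOrder _≈_ _<_
      +-mono-<           : ∀ {x y} z → x < y → (x + z) < (y + z)
      *-pos              : ∀ {x y} → 0# < x → 0# < y → 0# < (x * y)
      _⁻¹                : Carrier → Carrier
      ⁻¹-inverse         : ∀ x → ¬ (x ≈ 0#) → (x * (x ⁻¹)) ≈ 1#

record OrderedField (c ℓ ℓ' : Level) : Set (lsuc (c ⊔ ℓ ⊔ ℓ')) where
  field
    commRing       : CommutativeRing c ℓ
    isOrderedField : IsOrderedField commRing ℓ'
  open CommutativeRing commRing public
  open IsOrderedField isOrderedField public

record GradedPoset (n : ℕ) : Set₁ where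
  field
    _≼_            : Fin n → Fin n → Set
    ≼-dec          : Decidable _≼_
    isPartialOrder : IsPartialOrder _≡_ _≼_
    bot            : Fin n
    top            : Fin n
    bot-min        : ∀ x → bot ≼ x
    top-max        : ∀ x → x ≼ top
    ρ              : Fin n → ℕ
    ρ-bot          : ρ bot ≡ 0
    ρ-cover        : ∀ x y → x ≼ y → ¬ (x ≡ y) →
                     (∀ z → x ≼ z → z ≼ y → (z ≡ x) ⊎ (z ≡ y)) →
                     ρ y ≡ suc (ρ x)

allSubsets : (m : ℕ) → List (Vec Bool m)
allSubsets zero    = [] ∷ []
allSubsets (suc m) = map (true ∷_) (allSubsets m) ++ map (false ∷_) (allSubsets m)

card : {m : ℕ} → Vec Bool m → ℕ
card []            = 0
card (true  ∷ v)   = suc (card v)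
card (false ∷ v)   = card v

count : {A : Set} → (A → Bool) → List A → ℕ
count p []       = 0
count p (x ∷ xs) = if p x then suc (count p xs) else count p xs

module _ {n : ℕ} (P : GradedPoset n) where
  open GradedPoset P

  _≼ᵇ_ : Fin n → Fin n → Bool
  a ≼ᵇ b = ⌊ ≼-dec a b ⌋

  elems : List (Fin n)
  elems = allFin n

  rk : Fin n → Fin n → ℕ
  rk x y = ρ y ∸ ρ x

  -- C (a subset of P) is a chain of the interval [x,y] whose set of ranks
  -- (ranks in [x,y], i.e. ρ(x,z)) is exactly {i+1 | i ∈ T} ⊆ [1, m-1].
  isChainWithRanks : (x y : Fin n) → {m : ℕ} → Vec Bool m → Vec Bool n → Bool
  isChainWithRanks x y {m} T C =
       all (λ z → not (lookup C z) ∨ ((x ≼ᵇ z) ∧ (z ≼ᵇ y))) elems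
     ∧ all (λ z → all (λ w → not (lookup C z ∧ lookup C w) ∨ ((z ≼ᵇ w) ∨ (w ≼ᵇ z))) elems) elems
     ∧ all (λ z → not (lookup C z)
                  ∨ any (λ i → lookup T i ∧ (rk x z ≡ᵇ suc (toℕ i))) (allFin m)) elems
     ∧ all (λ i → not (lookup T i)
                  ∨ any (λ z → lookup C z ∧ (rk x z ≡ᵇ suc (toℕ i))) elems) (allFin m)

  -- f_T([x,y]) for T ⊆ [1, m-1], m = ρ(x,y), T encoded as a subset of Fin (m-1)
  -- (index i stands for rank i+1)
  flagF : (x y : Fin n) → Vec Bool (rk x y ∸ 1) → ℕ
  flagF x y T = count (isChainWithRanks x y T) (allSubsets n)

  module _ {c ℓ ℓ' : Level} (F : OrderedField c ℓ ℓ') where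
    open OrderedField F

    ℕ→F : ℕ → Carrier
    ℕ→F zero    = 0#
    ℕ→F (suc j) = 1# + ℕ→F j

    pow : Carrier → ℕ → Carrier
    pow a zero    = 1#
    pow a (suc j) = a * pow a j

    sgn : ℕ → Carrier
    sgn zero    = 1#
    sgn (suc j) = - sgn j

    sumF : {A : Set} → List A → (A → Carrier) → Carrier
    sumF xs g = foldr (λ a acc → g a + acc) 0# xs

    _=ᵇ_ : Fin n → Fin n → Bool
    a =ᵇ b = toℕ a ≡ᵇ toℕ b

    -- Defined by recursion with fuel; fuel n suffices since a strict chain
    -- in P has at most n elements (so the fuel-0 branch is never reached
    -- from μₖ below when x ≼ y).
    μfuel : Carrier → ℕ → Fin n → Fin n → Carrier
    μfuel k d x y with x =ᵇ y
    ... | true  = 1#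
    μfuel k zero    x y | false = - 1#
    μfuel k (suc d) x y | false =
      - 1# - (k ⁻¹) * sumF elems (λ z →
          if (x ≼ᵇ z) ∧ not (x =ᵇ z) ∧ (z ≼ᵇ y) ∧ not (z =ᵇ y)
          then μfuel k d x z else 0#)

    μₖ : Carrier → Fin n → Fin n → Carrier
    μₖ k x y = μfuel k n x y

    IsKEulerian : Carrier → Set ℓ
    IsKEulerian k = ∀ x y → x ≼ y → μₖ k x y ≈ sgn (rk x y)

    complSub : {m : ℕ} → Vec Bool m → Vec Bool m → Bool
    complSub []      []      = true
    complSub (s ∷ S) (t ∷ T) = (s ∨ t) ∧ complSub S T

    Lkm : Carrier → (x y : Fin n) → Vec Bool (rk x y ∸ 1) → Carrier
    Lkm k x y S =
      sgn ((rk x y ∸ 1) ∸ card S) *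
      sumF (allSubsets (rk x y ∸ 1)) (λ T →
        if complSub S T
        then pow (- ((k + k) ⁻¹)) (card T) * ℕ→F (flagF x y T)
        else 0#)

    fullSet : (m : ℕ) → Vec Bool m
    fullSet zero    = []
    fullSet (suc m) = true ∷ fullSet m

module Submission where

open import Defs
open import Level using (Level; _⊔_)
open import Algebra.Bundles using (CommutativeMonoid; Semiring; CommutativeRing; Ring)
open import Data.Nat as ℕ using (ℕ; zero; suc; _<_; _≤_; _∸_)
import Data.Nat.Properties as ℕ
open import Data.Nat.Divisibility using (_∣_; divides)
open import Data.Fin as Fin using (Fin; zero; suc; toℕ)
open import Data.Fin.Properties using (all?; any?; ¬∀⟶∃¬; toℕ-injective; toℕ-fromℕ<; toℕ<n)
open import Data.Fin.Subset using (∣_∣)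
open import Data.Fin.Subset.Properties using (p⊂q⇒∣p∣<∣q∣)
import Algebra.Properties.Semiring.Sum
open import Data.Vec as Vec using (Vec; []; _∷_; lookup; tabulate; replicate; _[_]≔_)
open import Data.Vec.Properties using (tabulate∘lookup; tabulate-cong; lookup∘tabulate; lookup-replicate; lookup∘update; lookup∘update′)
open import Data.Unit using (tt)
import Data.List as List
open import Data.Bool using (Bool; true; false; T; _∧_; if_then_else_)
open import Data.Bool.Properties using (if-cong; T-≡)
open import Data.Product using (∃; _×_; _,_; proj₁; proj₂)
open import Data.Sum using (_⊎_; inj₁; inj₂)
open import Function using (_∘_; id; _⟨_⟩_)
open import Function.Bundles using (_⇔_; mk⇔; Equivalence)
import Function.Properties.Equivalence as ⇔
open import Relation.Binary using (Rel; Decidable; DecidableEquality; IsPartialOrder; IsStrictTotalOrder)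
open import Relation.Binary.PropositionalEquality as ≡ using (_≡_; _≢_)
open import Relation.Nullary using (Dec; yes; no; does; proof; ofʸ; ofⁿ; ¬_; contradiction; _×-dec_; _⊎-dec_; _→-dec_; ¬?)
open import Relation.Nullary.Decidable using (map′; dec-true; dec-false; does-⇔; T?)

-- Work in the incidence algebra of P over F, with E the strict zeta function,
-- q = 1/(2k), B = 1 + qE and D = 1 + 2qE, and let σ multiply the entry at
-- (x, y) by (-1)^ρ(x,y); σ is conjugation by a diagonal sign matrix, hence an
-- algebra automorphism.  The recursion for μ_k says that ν = μ_k - 1 satisfies
-- νD = -E, so P is k-Eulerian iff σE·D = -E.  Sorting the chains of an open
-- interval by their top element shows that the strictly upper part h of the
-- matrix of the numbers L_{[1,m-1]} satisfies hB = E.  Since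
-- σB·(h + σh)·B = E + σE·D, both conditions say E + σE·D = 0; finally
-- h + σh vanishes exactly when h vanishes on intervals of even rank, as it
-- vanishes identically on odd ones.

witness : ∀ {A : Set} (a? : Dec A) → does a? ≡ true → A
witness (yes a) _ = a

module FiniteSums {c ℓ : Level} (M : CommutativeMonoid c ℓ) where
  open CommutativeMonoid M renaming (Carrier to A)
  open import Algebra.Properties.CommutativeMonoid.Sum M
    using (sum; sum-cong-≋; sum-replicate-zero; sum-remove; ∑-distrib-+)
  open import Algebra.Properties.CommutativeSemigroup commutativeSemigroup using (interchange)
  open import Data.Fin.Properties using (punchInᵢ≢i)
  open import Data.Vec.Functional using (Vector)
  open import Data.Vec.Properties using (∷-injectiveʳ)

  sum-zero : ∀ {m} {f : Vector A m} → (∀ i → f i ≈ ε) → sum f ≈ ε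
  sum-zero {m} f≈ε = trans (sum-cong-≋ f≈ε) (sum-replicate-zero m)

  sum-single : ∀ {m} {f : Vector A m} j → (∀ i → i ≢ j → f i ≈ ε) → sum f ≈ f j
  sum-single {suc m} {f} j others≈ε =
    trans (sum-remove f) (trans (∙-congˡ (sum-zero λ i → others≈ε _ (punchInᵢ≢i j i))) (identityʳ _))

  ∑ₛ : ∀ m → (Vec Bool m → A) → A
  ∑ₛ zero    F = F []
  ∑ₛ (suc m) F = ∑ₛ m (F ∘ (true ∷_)) ∙ ∑ₛ m (F ∘ (false ∷_))

  ∑ₛ-cong : ∀ m {F G : Vec Bool m → A} → (∀ S → F S ≈ G S) → ∑ₛ m F ≈ ∑ₛ m G
  ∑ₛ-cong zero    F≈G = F≈G []
  ∑ₛ-cong (suc m) F≈G = ∙-cong (∑ₛ-cong m (F≈G ∘ (true ∷_))) (∑ₛ-cong m (F≈G ∘ (false ∷_)))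

  ∑ₛ-zero : ∀ m {F : Vec Bool m → A} → (∀ S → F S ≈ ε) → ∑ₛ m F ≈ ε
  ∑ₛ-zero zero    F≈ε = F≈ε []
  ∑ₛ-zero (suc m) F≈ε =
    trans (∙-cong (∑ₛ-zero m (F≈ε ∘ (true ∷_))) (∑ₛ-zero m (F≈ε ∘ (false ∷_)))) (identityˡ ε)

  ∑ₛ-distrib : ∀ m (F G : Vec Bool m → A) → ∑ₛ m (λ S → F S ∙ G S) ≈ ∑ₛ m F ∙ ∑ₛ m G
  ∑ₛ-distrib zero    F G = refl
  ∑ₛ-distrib (suc m) F G = trans (∙-cong (∑ₛ-distrib m _ _) (∑ₛ-distrib m _ _)) (interchange _ _ _ _)

  ∑ₛ-single : ∀ m {F : Vec Bool m → A} S₀ → (∀ S → S ≢ S₀ → F S ≈ ε) → ∑ₛ m F ≈ F S₀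
  ∑ₛ-single zero    []          others≈ε = refl
  ∑ₛ-single (suc m) (true ∷ S₀) others≈ε =
    trans (∙-cong (∑ₛ-single m S₀ λ S S≢S₀ → others≈ε _ (S≢S₀ ∘ ∷-injectiveʳ))
                  (∑ₛ-zero m λ S → others≈ε _ λ ()))
          (identityʳ _)
  ∑ₛ-single (suc m) (false ∷ S₀) others≈ε =
    trans (∙-cong (∑ₛ-zero m λ S → others≈ε _ λ ())
                  (∑ₛ-single m S₀ λ S S≢S₀ → others≈ε _ (S≢S₀ ∘ ∷-injectiveʳ)))
          (identityˡ _)

  ∑ₛ-insert : ∀ m (z : Fin m) (F : Vec Bool m → A) →
              ∑ₛ m (λ S → if lookup S z then F S else ε) ≈
              ∑ₛ m (λ S → if lookup S z then ε else F (S [ z ]≔ true))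
  ∑ₛ-insert (suc m) zero    F = comm _ _
  ∑ₛ-insert (suc m) (suc z) F = ∙-cong (∑ₛ-insert m z (F ∘ (true ∷_))) (∑ₛ-insert m z (F ∘ (false ∷_)))

  module _ {X : Set} (Op : (X → A) → A)
           (Op-cong : ∀ {f g} → (∀ x → f x ≈ g x) → Op f ≈ Op g)
           (Op-distrib : ∀ f g → Op (λ x → f x ∙ g x) ≈ Op f ∙ Op g)
           (Op-zero : Op (λ _ → ε) ≈ ε) where

    ∑ₛ-interchange : ∀ m (f : Vec Bool m → X → A) →
                     ∑ₛ m (λ S → Op (f S)) ≈ Op (λ x → ∑ₛ m (λ S → f S x))
    ∑ₛ-interchange zero    f = refl
    ∑ₛ-interchange (suc m) f =
      trans (∙-cong (∑ₛ-interchange m _) (∑ₛ-interchange m _)) (sym (Op-distrib _ _))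

  ∑ₛ-sum-comm : ∀ m {p} (f : Vec Bool m → Fin p → A) →
                ∑ₛ m (λ S → sum (f S)) ≈ sum (λ z → ∑ₛ m (λ S → f S z))
  ∑ₛ-sum-comm m {p} = ∑ₛ-interchange sum sum-cong-≋ ∑-distrib-+ (sum-replicate-zero p) m

  ∑ₛ-comm : ∀ m p (f : Vec Bool m → Vec Bool p → A) →
            ∑ₛ m (λ S → ∑ₛ p (f S)) ≈ ∑ₛ p (λ S′ → ∑ₛ m (λ S → f S S′))
  ∑ₛ-comm m p = ∑ₛ-interchange (∑ₛ p) (∑ₛ-cong p) (∑ₛ-distrib p) (∑ₛ-zero p λ _ → refl) m

module SemiringSums {c ℓ : Level} (S : Semiring c ℓ) where
  open Semiring S
  open FiniteSums +-commutativeMonoid using (∑ₛ)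

  *-distribˡ-∑ₛ : ∀ m a (F : Vec Bool m → Carrier) → a * ∑ₛ m F ≈ ∑ₛ m (λ S → a * F S)
  *-distribˡ-∑ₛ zero    a F = refl
  *-distribˡ-∑ₛ (suc m) a F = trans (distribˡ a _ _) (+-cong (*-distribˡ-∑ₛ m a _) (*-distribˡ-∑ₛ m a _))

-- Deciders whose `does` is literally the list-based `all`/`any` used in Defs.
module _ {A : Set} {P : A → Set} (P? : ∀ a → Dec (P a)) where
  open import Data.Bool.ListAction using (all; any)
  open import Data.Sum using ([_,_])

  all-tabulate? : ∀ {m} (g : Fin m → A) → Dec (∀ i → P (g i))
  does  (all-tabulate? g) = all (does ∘ P?) (List.tabulate g)
  proof (all-tabulate? {zero}  g) = proof (yes λ ())
  proof (all-tabulate? {suc m} g) = proof (map′ (λ (p₀ , p₊) → λ { zero → p₀ ; (suc i) → p₊ i })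
                                                 (λ p → p zero , p ∘ suc)
                                                 (P? (g zero) ×-dec all-tabulate? (g ∘ suc)))

  any-tabulate? : ∀ {m} (g : Fin m → A) → Dec (∃ λ i → P (g i))
  does  (any-tabulate? g) = any (does ∘ P?) (List.tabulate g)
  proof (any-tabulate? {zero}  g) = proof (no λ ())
  proof (any-tabulate? {suc m} g) = proof (map′ [ (λ p₀ → zero , p₀) , (λ (i , pᵢ) → suc i , pᵢ) ]
                                                 (λ { (zero , p₀) → inj₁ p₀ ; (suc i , pᵢ) → inj₂ (i , pᵢ) })
                                                 (P? (g zero) ⊎-dec any-tabulate? (g ∘ suc)))

module Indicators {c ℓ : Level} (S : Semiring c ℓ) where
  open Semiring S
  open import Algebra.Properties.Semiring.Sum S using (sum)
  open FiniteSums +-commutativeMonoid using (sum-zero; sum-single)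

  𝟙 : Bool → Carrier
  𝟙 b = if b then 1# else 0#

  𝟙-∧ : ∀ a b → 𝟙 (a ∧ b) ≈ 𝟙 a * 𝟙 b
  𝟙-∧ false b     = sym (zeroˡ _)
  𝟙-∧ true  false = sym (zeroʳ _)
  𝟙-∧ true  true  = sym (*-identityʳ _)

  𝟙-yes : ∀ {A : Set} (a? : Dec A) → A → 𝟙 (does a?) ≈ 1#
  𝟙-yes a? a = reflexive (if-cong (dec-true a? a))

  𝟙-no : ∀ {A : Set} (a? : Dec A) → ¬ A → 𝟙 (does a?) ≈ 0#
  𝟙-no a? ¬a = reflexive (if-cong (dec-false a? ¬a))

  if≈𝟙* : ∀ b {v} → (if b then v else 0#) ≈ 𝟙 b * v
  if≈𝟙* false = sym (zeroˡ _)
  if≈𝟙* true  = sym (*-identityˡ _)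

  if-∧≈* : ∀ a b v → (if a ∧ b then v else 0#) ≈ (if a then v else 0#) * 𝟙 b
  if-∧≈* false b     v = sym (zeroˡ _)
  if-∧≈* true  false v = sym (zeroʳ v)
  if-∧≈* true  true  v = sym (*-identityʳ v)

  if-does-cong : ∀ {A : Set} (a? : Dec A) {u v} → (A → u ≈ v) →
                 (if does a? then u else 0#) ≈ (if does a? then v else 0#)
  if-does-cong (yes a) u≈v = u≈v a
  if-does-cong (no _)  _   = refl

  𝟙-any≈sum : ∀ {m} {P : Fin m → Set} (P? : ∀ i → Dec (P i)) →
              (∀ {i j} → P i → P j → i ≡ j) → 𝟙 (does (any? P?)) ≈ sum (𝟙 ∘ does ∘ P?)
  𝟙-any≈sum P? unique with any? P?
  ... | yes (j , pⱼ) = sym (trans (sum-single j λ i i≢j → 𝟙-no (P? i) (λ pᵢ → i≢j (unique pᵢ pⱼ))) (𝟙-yes (P? j) pⱼ))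
  ... | no ∄P       = sym (sum-zero λ i → 𝟙-no (P? i) (λ pᵢ → ∄P (i , pᵢ)))

module Matrices {c ℓ : Level} (R : CommutativeRing c ℓ) (n : ℕ) where
  open CommutativeRing R
  import Algebra.Construct.Pointwise as Pointwise
  open import Data.Fin using (_≟_)
  open import Algebra.Properties.Semiring.Sum semiring
    using (sum; sum-cong-≋; ∑-comm; ∑-distrib-+; *-distribˡ-sum; *-distribʳ-sum)
  open FiniteSums +-commutativeMonoid using (sum-single)
  open import Algebra.Solver.CommutativeMonoid *-commutativeMonoid using (solve; _⊜_; _⊕_)
  open import Relation.Binary.Reasoning.Setoid setoid

  Matrix : Set c
  Matrix = Fin n → Fin n → Carrier

  infix  4 _≐_
  infixl 6 _⊞_
  infixl 7 _⋆_ _·_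
  infix  8 ⊟_

  _≐_ : Matrix → Matrix → Set ℓ
  f ≐ g = ∀ x y → f x y ≈ g x y

  _⊞_ : Matrix → Matrix → Matrix
  (f ⊞ g) x y = f x y + g x y

  ⊟_ : Matrix → Matrix
  (⊟ f) x y = - f x y

  𝟘 : Matrix
  𝟘 x y = 0#

  I : Matrix
  I x y = if does (x ≟ y) then 1# else 0#

  _⋆_ : Matrix → Matrix → Matrix
  (f ⋆ g) x y = sum λ z → f x z * g z y

  _·_ : Carrier → Matrix → Matrix
  (a · f) x y = a * f x y

  I-diag : ∀ x → I x x ≈ 1#
  I-diag x = reflexive (if-cong (dec-true (x ≟ x) ≡.refl))

  I-off : ∀ {x y} → x ≢ y → I x y ≈ 0#
  I-off {x} {y} x≢y = reflexive (if-cong (dec-false (x ≟ y) x≢y))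

  ⋆-cong : ∀ {f f′ g g′} → f ≐ f′ → g ≐ g′ → f ⋆ g ≐ f′ ⋆ g′
  ⋆-cong f≐f′ g≐g′ x y = sum-cong-≋ {n} λ z → *-cong (f≐f′ x z) (g≐g′ z y)

  ⋆-assoc : ∀ f g h → (f ⋆ g) ⋆ h ≐ f ⋆ (g ⋆ h)
  ⋆-assoc f g h x y = begin
    sum (λ w → sum (λ z → f x z * g z w) * h w y)   ≈⟨ sum-cong-≋ {n} (λ w → *-distribʳ-sum (h w y) (λ z → f x z * g z w)) ⟩
    sum (λ w → sum (λ z → f x z * g z w * h w y))   ≈⟨ ∑-comm {n} {n} _ ⟩
    sum (λ z → sum (λ w → f x z * g z w * h w y))   ≈⟨ sum-cong-≋ {n} (λ z → sum-cong-≋ {n} λ w → *-assoc _ _ _) ⟩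
    sum (λ z → sum (λ w → f x z * (g z w * h w y))) ≈⟨ sum-cong-≋ {n} (λ z → *-distribˡ-sum (f x z) (λ w → g z w * h w y)) ⟨
    sum (λ z → f x z * sum (λ w → g z w * h w y))   ∎

  ⋆-identityˡ : ∀ f → I ⋆ f ≐ f
  ⋆-identityˡ f x y = begin
    sum (λ z → I x z * f z y) ≈⟨ sum-single x (λ z z≢x → trans (*-congʳ (I-off (z≢x ∘ ≡.sym))) (zeroˡ _)) ⟩
    I x x * f x y             ≈⟨ trans (*-congʳ (I-diag x)) (*-identityˡ _) ⟩
    f x y                     ∎

  ⋆-identityʳ : ∀ f → f ⋆ I ≐ f
  ⋆-identityʳ f x y = begin
    sum (λ z → f x z * I z y) ≈⟨ sum-single y (λ z z≢y → trans (*-congˡ (I-off z≢y)) (zeroʳ _)) ⟩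
    f x y * I y y             ≈⟨ trans (*-congˡ (I-diag y)) (*-identityʳ _) ⟩
    f x y                     ∎

  ⋆-distribˡ : ∀ f g h → f ⋆ (g ⊞ h) ≐ f ⋆ g ⊞ f ⋆ h
  ⋆-distribˡ f g h x y = trans (sum-cong-≋ {n} λ z → distribˡ _ _ _) (∑-distrib-+ (λ z → f x z * g z y) _)

  ⋆-distribʳ : ∀ f g h → (g ⊞ h) ⋆ f ≐ g ⋆ f ⊞ h ⋆ f
  ⋆-distribʳ f g h x y = trans (sum-cong-≋ {n} λ z → distribʳ _ _ _) (∑-distrib-+ (λ z → g x z * f z y) _)

  matrixRing : Ring c ℓ
  matrixRing = record
    { Carrier = Matrix
    ; _≈_     = _≐_
    ; _+_     = _⊞_
    ; _*_     = _⋆_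
    ; -_      = ⊟_
    ; 0#      = 𝟘
    ; 1#      = I
    ; isRing  = record
      { +-isAbelianGroup = Pointwise.isAbelianGroup (Fin n) (Pointwise.isAbelianGroup (Fin n) +-isAbelianGroup)
      ; *-cong           = ⋆-cong
      ; *-assoc          = ⋆-assoc
      ; *-identity       = ⋆-identityˡ , ⋆-identityʳ
      ; distrib          = ⋆-distribˡ , ⋆-distribʳ
      }
    }

  scalar : Carrier → Matrix
  scalar a = a · I

  scalar-⋆ : ∀ a f → scalar a ⋆ f ≐ a · f
  scalar-⋆ a f x y = trans (sum-cong-≋ {n} λ z → *-assoc _ _ _)
                   (trans (sym (*-distribˡ-sum a (λ z → I x z * f z y))) (*-congˡ (⋆-identityˡ f x y)))

  ⋆-scalar : ∀ a f → f ⋆ scalar a ≐ a · f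
  ⋆-scalar a f x y = trans (sum-cong-≋ {n} λ z → trans (*-congˡ (*-comm a _)) (sym (*-assoc _ _ _)))
                   (trans (sym (*-distribʳ-sum a (λ z → f x z * I z y))) (trans (*-comm _ a) (*-congˡ (⋆-identityʳ f x y))))

  ⋆-· : ∀ a f g → f ⋆ (a · g) ≐ a · (f ⋆ g)
  ⋆-· a f g x y = trans (sum-cong-≋ {n} λ z → x*[a*y]≈a*[x*y] (f x z) (g z y)) (sym (*-distribˡ-sum a (λ z → f x z * g z y)))
    where
    x*[a*y]≈a*[x*y] : ∀ u v → u * (a * v) ≈ a * (u * v)
    x*[a*y]≈a*[x*y] u v = solve 3 (λ a u v → u ⊕ (a ⊕ v) ⊜ a ⊕ (u ⊕ v)) refl a u v

  ⋆-I⊞scalar : ∀ a f g → f ⋆ (I ⊞ scalar a ⋆ g) ≐ f ⊞ a · (f ⋆ g)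
  ⋆-I⊞scalar a f g x y = begin
    (f ⋆ (I ⊞ scalar a ⋆ g)) x y         ≈⟨ ⋆-distribˡ f I (scalar a ⋆ g) x y ⟩
    (f ⋆ I) x y + (f ⋆ (scalar a ⋆ g)) x y ≈⟨ +-cong (⋆-identityʳ f x y) (⋆-cong {f} (λ _ _ → refl) (scalar-⋆ a g) x y) ⟩
    f x y + (f ⋆ (a · g)) x y             ≈⟨ +-congˡ (⋆-· a f g x y) ⟩
    f x y + a * (f ⋆ g) x y               ∎

  scalar-central : ∀ a f → scalar a ⋆ f ≐ f ⋆ scalar a
  scalar-central a f x y = trans (scalar-⋆ a f x y) (sym (⋆-scalar a f x y))

  scalar-+ : ∀ a b → scalar a ⊞ scalar b ≐ scalar (a + b)
  scalar-+ a b x y = sym (distribʳ _ a b)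

  module Conjugation (s : Fin n → Carrier) (s²≈1 : ∀ x → s x * s x ≈ 1#) where

    conj : Matrix → Matrix
    conj f x y = s x * f x y * s y

    conj-cong : ∀ {f g} → f ≐ g → conj f ≐ conj g
    conj-cong f≐g x y = *-congʳ (*-congˡ (f≐g x y))

    conj-⊞ : ∀ f g → conj (f ⊞ g) ≐ conj f ⊞ conj g
    conj-⊞ f g x y = trans (*-congʳ (distribˡ _ _ _)) (distribʳ _ _ _)

    conj-· : ∀ a f → conj (a · f) ≐ a · conj f
    conj-· a f x y = solve 4 (λ sx a f sy → (sx ⊕ (a ⊕ f)) ⊕ sy ⊜ a ⊕ ((sx ⊕ f) ⊕ sy)) refl (s x) a (f x y) (s y)

    conj-I : conj I ≐ I
    conj-I x y with x ≟ y
    ... | yes ≡.refl = trans (*-congʳ (*-identityʳ _)) (s²≈1 x)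
    ... | no _       = trans (*-congʳ (zeroʳ _)) (zeroˡ _)

    conj-scalar : ∀ a → conj (scalar a) ≐ scalar a
    conj-scalar a x y = trans (conj-· a I x y) (*-congˡ (conj-I x y))

    conj-⋆ : ∀ f g → conj (f ⋆ g) ≐ conj f ⋆ conj g
    conj-⋆ f g x y = begin
      s x * sum (λ z → f x z * g z y) * s y               ≈⟨ *-congʳ (*-distribˡ-sum (s x) (λ z → f x z * g z y)) ⟩
      sum (λ z → s x * (f x z * g z y)) * s y             ≈⟨ *-distribʳ-sum (s y) (λ z → s x * (f x z * g z y)) ⟩
      sum (λ z → s x * (f x z * g z y) * s y)             ≈⟨ sum-cong-≋ {n} (λ z → sym (insert-s² z)) ⟩
      sum (λ z → (s x * f x z * s z) * (s z * g z y * s y)) ∎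
      where
      insert-s² : ∀ z → (s x * f x z * s z) * (s z * g z y * s y) ≈ s x * (f x z * g z y) * s y
      insert-s² z = begin
        (s x * f x z * s z) * (s z * g z y * s y)   ≈⟨ solve 5 (λ a b c d e → ((a ⊕ b) ⊕ c) ⊕ ((c ⊕ d) ⊕ e) ⊜ ((a ⊕ (b ⊕ d)) ⊕ e) ⊕ (c ⊕ c)) refl (s x) (f x z) (s z) (g z y) (s y) ⟩
        (s x * (f x z * g z y) * s y) * (s z * s z) ≈⟨ *-congˡ (s²≈1 z) ⟩
        (s x * (f x z * g z y) * s y) * 1#          ≈⟨ *-identityʳ _ ⟩
        s x * (f x z * g z y) * s y                 ∎

module Reciprocity {c ℓ : Level} (R : Ring c ℓ) where
  open Ring R
  open import Algebra.Properties.Ring R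
    using ([y-z]x≈yx-zx; x∙y⁻¹≈ε⇒x≈y; -‿+-comm; -0#≈0#)
  open import Algebra.Solver.CommutativeMonoid +-commutativeMonoid using (solve; _⊜_; _⊕_)
  open import Relation.Binary.Reasoning.Setoid setoid

  RightCancellable : Carrier → Set (c ⊔ ℓ)
  RightCancellable b = ∀ d → d * b ≈ 0# → d ≈ 0#

  module WithEndomorphism (σ : Carrier → Carrier)
                          (σ-cong : ∀ {a b} → a ≈ b → σ a ≈ σ b)
                          (σ-+ : ∀ a b → σ (a + b) ≈ σ a + σ b)
                          (σ-* : ∀ a b → σ (a * b) ≈ σ a * σ b)
                          (σ-1 : σ 1# ≈ 1#)
                          (κ e : Carrier)
                          (κ-central : ∀ a → κ * a ≈ a * κ)
                          (σκ≈κ : σ κ ≈ κ)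
                          where

    B D Y : Carrier
    B = 1# + κ * e
    D = 1# + (κ + κ) * e
    Y = e + σ e * D

    σ-fixed⇔Y≈0 : ∀ {ν} → RightCancellable D → ν * D ≈ - e → ν ≈ σ e ⇔ Y ≈ 0#
    σ-fixed⇔Y≈0 {ν} cancelD νD≈-e = mk⇔ to from
      where
      to : ν ≈ σ e → Y ≈ 0#
      to ν≈σe = begin
        e + σ e * D ≈⟨ +-congˡ (*-congʳ ν≈σe) ⟨
        e + ν * D   ≈⟨ +-congˡ νD≈-e ⟩
        e - e       ≈⟨ -‿inverseʳ e ⟩
        0#          ∎
      from : Y ≈ 0# → ν ≈ σ e
      from Y≈0 = x∙y⁻¹≈ε⇒x≈y ν (σ e) (cancelD (ν - σ e) (begin
        (ν - σ e) * D       ≈⟨ [y-z]x≈yx-zx D ν (σ e) ⟩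
        ν * D - σ e * D     ≈⟨ +-congʳ νD≈-e ⟩
        - e - σ e * D       ≈⟨ -‿+-comm e (σ e * D) ⟩
        - Y                 ≈⟨ -‿cong Y≈0 ⟩
        - 0#                ≈⟨ -0#≈0# ⟩
        0#                  ∎))

    eB≈Be : e * B ≈ B * e
    eB≈Be = begin
      e * (1# + κ * e)        ≈⟨ distribˡ e 1# (κ * e) ⟩
      e * 1# + e * (κ * e)    ≈⟨ +-cong (*-identityʳ e) (sym (*-assoc e κ e)) ⟩
      e + e * κ * e           ≈⟨ +-cong (*-identityˡ e) (*-congʳ (κ-central e)) ⟨
      1# * e + κ * e * e      ≈⟨ distribʳ e 1# (κ * e) ⟨
      (1# + κ * e) * e        ∎

    σB·e+σe·B≈Y : σ B * e + σ e * B ≈ Y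
    σB·e+σe·B≈Y = begin
      σ B * e + σ e * B                                   ≈⟨ +-congʳ (*-congʳ σB≈) ⟩
      (1# + κ * σ e) * e + σ e * (1# + κ * e)             ≈⟨ +-cong (distribʳ e 1# (κ * σ e)) (distribˡ (σ e) 1# (κ * e)) ⟩
      (1# * e + κ * σ e * e) + (σ e * 1# + σ e * (κ * e)) ≈⟨ +-cong (+-cong (*-identityˡ e) (*-congʳ (κ-central (σ e))))
                                                                      (+-cong (*-identityʳ (σ e)) (sym (*-assoc (σ e) κ e))) ⟩
      (e + t) + (σ e + t)                                 ≈⟨ solve 3 (λ a b c → (a ⊕ c) ⊕ (b ⊕ c) ⊜ a ⊕ (b ⊕ (c ⊕ c))) refl e (σ e) t ⟩
      e + (σ e + (t + t))                                 ≈⟨ +-congˡ σe·D≈ ⟨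
      Y                                                   ∎
      where
      t : Carrier
      t = σ e * κ * e
      σB≈ : σ B ≈ 1# + κ * σ e
      σB≈ = trans (σ-+ 1# (κ * e)) (+-cong σ-1 (trans (σ-* κ e) (*-congʳ σκ≈κ)))
      σe·D≈ : σ e * D ≈ σ e + (t + t)
      σe·D≈ = begin
        σ e * (1# + (κ + κ) * e)               ≈⟨ distribˡ (σ e) 1# ((κ + κ) * e) ⟩
        σ e * 1# + σ e * ((κ + κ) * e)         ≈⟨ +-cong (*-identityʳ (σ e)) (sym (*-assoc (σ e) (κ + κ) e)) ⟩
        σ e + σ e * (κ + κ) * e                ≈⟨ +-congˡ (*-congʳ (distribˡ (σ e) κ κ)) ⟩
        σ e + (σ e * κ + σ e * κ) * e          ≈⟨ +-congˡ (distribʳ e (σ e * κ) (σ e * κ)) ⟩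
        σ e + (t + t)                          ∎

    module _ {h} (cancelB : RightCancellable B) (hB≈e : h * B ≈ e) where

      [1-κh]B≈1 : (1# - κ * h) * B ≈ 1#
      [1-κh]B≈1 = begin
        (1# - κ * h) * B        ≈⟨ [y-z]x≈yx-zx B 1# (κ * h) ⟩
        1# * B - κ * h * B      ≈⟨ +-cong (*-identityˡ B) (-‿cong (trans (*-assoc κ h B) (*-congˡ hB≈e))) ⟩
        (1# + κ * e) - κ * e    ≈⟨ +-assoc 1# (κ * e) (- (κ * e)) ⟩
        1# + (κ * e - κ * e)    ≈⟨ +-congˡ (-‿inverseʳ (κ * e)) ⟩
        1# + 0#                 ≈⟨ +-identityʳ 1# ⟩
        1#                      ∎

      Bh≈e : B * h ≈ e
      Bh≈e = x∙y⁻¹≈ε⇒x≈y (B * h) e (cancelB (B * h - e) (begin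
        (B * h - e) * B         ≈⟨ [y-z]x≈yx-zx B (B * h) e ⟩
        B * h * B - e * B       ≈⟨ +-cong (trans (*-assoc B h B) (*-congˡ hB≈e)) (-‿cong eB≈Be) ⟩
        B * e - B * e           ≈⟨ -‿inverseʳ (B * e) ⟩
        0#                      ∎))

      σB·[h+σh]·B≈Y : σ B * (h + σ h) * B ≈ Y
      σB·[h+σh]·B≈Y = begin
        σ B * (h + σ h) * B                    ≈⟨ *-assoc (σ B) (h + σ h) B ⟩
        σ B * ((h + σ h) * B)                  ≈⟨ *-congˡ (distribʳ B h (σ h)) ⟩
        σ B * (h * B + σ h * B)                ≈⟨ distribˡ (σ B) (h * B) (σ h * B) ⟩
        σ B * (h * B) + σ B * (σ h * B)        ≈⟨ +-cong (*-congˡ hB≈e) (sym (*-assoc (σ B) (σ h) B)) ⟩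
        σ B * e + σ B * σ h * B                ≈⟨ +-congˡ (*-congʳ (trans (sym (σ-* B h)) (σ-cong Bh≈e))) ⟩
        σ B * e + σ e * B                      ≈⟨ σB·e+σe·B≈Y ⟩
        Y                                      ∎

      σ-antisymmetric⇔Y≈0 : h + σ h ≈ 0# ⇔ Y ≈ 0#
      σ-antisymmetric⇔Y≈0 = mk⇔ to from
        where
        to : h + σ h ≈ 0# → Y ≈ 0#
        to h+σh≈0 = begin
          Y                   ≈⟨ σB·[h+σh]·B≈Y ⟨
          σ B * (h + σ h) * B ≈⟨ *-congʳ (*-congˡ h+σh≈0) ⟩
          σ B * 0# * B        ≈⟨ *-congʳ (zeroʳ (σ B)) ⟩
          0# * B              ≈⟨ zeroˡ B ⟩
          0#                  ∎
        from : Y ≈ 0# → h + σ h ≈ 0#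
        from Y≈0 = cancelB (h + σ h) (begin
          (h + σ h) * B                            ≈⟨ *-identityˡ _ ⟨
          1# * ((h + σ h) * B)                     ≈⟨ *-congʳ (trans (sym (σ-* _ B)) (trans (σ-cong [1-κh]B≈1) σ-1)) ⟨
          σ (1# - κ * h) * σ B * ((h + σ h) * B)   ≈⟨ *-assoc _ (σ B) _ ⟩
          σ (1# - κ * h) * (σ B * ((h + σ h) * B)) ≈⟨ *-congˡ (trans (sym (*-assoc (σ B) (h + σ h) B)) σB·[h+σh]·B≈Y) ⟩
          σ (1# - κ * h) * Y                       ≈⟨ *-congˡ Y≈0 ⟩
          σ (1# - κ * h) * 0#                      ≈⟨ zeroʳ _ ⟩
          0#                                       ∎)

module GradedPosetProperties {n : ℕ} (P : GradedPoset n) where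
  open GradedPoset P
  open import Data.Nat.Properties using (≤-refl; <-trans; <-≤-trans; ≤-pred; <⇒≤; m∸n+n≡m; +-∸-assoc; +-comm; m<n⇒0<n∸m)
  open import Data.Fin.Subset using (Subset; _∈_; _⊂_; ⁅_⁆)
  open import Data.Fin.Subset.Properties using (∣⁅x⁆∣≡1; x∈⁅y⁆⇒x≡y)
  open import Data.Vec.Properties using ([]=⇒lookup; lookup⇒[]=)
  open ≡ using (refl; sym; trans; cong)
  open import Data.Nat using (_+_)
  open IsPartialOrder isPartialOrder public
    using () renaming (refl to ≼-refl; trans to ≼-trans; antisym to ≼-antisym)

  -- `does (x ≟ y)` and `does (x ≼? y)` are, definitionally, the Booleans
  -- `x =ᵇ y` and `x ≼ᵇ y` of Defs, so that Defs' Boolean tests unfold to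
  -- decisions made here.
  _≟_ : DecidableEquality (Fin n)
  x ≟ y = map′ toℕ-injective (cong toℕ) (toℕ x ℕ.≟ toℕ y)

  _≼?_ : Decidable _≼_
  does  (x ≼? y) = _≼ᵇ_ P x y
  proof (x ≼? y) with ≼-dec x y
  ... | yes x≼y = ofʸ x≼y
  ... | no x⋠y  = ofⁿ x⋠y

  infix 4 _≺_ _≺?_
  _≺_ : Rel (Fin n) _
  x ≺ y = x ≼ y × x ≢ y

  _≺?_ : Decidable _≺_
  x ≺? y = x ≼? y ×-dec ¬? (x ≟ y)

  ≺-trans : ∀ {x y z} → x ≺ y → y ≺ z → x ≺ z
  ≺-trans (x≼y , x≢y) (y≼z , y≢z) =
    ≼-trans x≼y y≼z , λ { refl → x≢y (≼-antisym x≼y y≼z) }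

  ≼-≺-trans : ∀ {x y z} → x ≼ y → y ≺ z → x ≺ z
  ≼-≺-trans x≼y (y≼z , y≢z) =
    ≼-trans x≼y y≼z , λ { refl → y≢z (≼-antisym y≼z x≼y) }

  ≺-irrefl : ∀ {x} → ¬ x ≺ x
  ≺-irrefl (_ , x≢x) = x≢x refl

  interval : Fin n → Fin n → Subset n
  interval x y = tabulate λ z → does (x ≼? z ×-dec z ≼? y)

  module _ {x y z : Fin n} where

    ∈-interval⁺ : x ≼ z → z ≼ y → z ∈ interval x y
    ∈-interval⁺ x≼z z≼y =
      lookup⇒[]= z _ (trans (lookup∘tabulate _ z) (dec-true (x ≼? z ×-dec z ≼? y) (x≼z , z≼y)))

    ∈-interval⁻ : z ∈ interval x y → x ≼ z × z ≼ y
    ∈-interval⁻ z∈ = witness (x ≼? z ×-dec z ≼? y) (trans (sym (lookup∘tabulate _ z)) ([]=⇒lookup z∈))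

  interval-⊂ˡ : ∀ {x y z} → x ≼ z → z ≺ y → interval x z ⊂ interval x y
  interval-⊂ˡ x≼z (z≼y , z≢y) =
    (λ w∈ → let x≼w , w≼z = ∈-interval⁻ w∈ in ∈-interval⁺ x≼w (≼-trans w≼z z≼y)) ,
    _ , ∈-interval⁺ (≼-trans x≼z z≼y) ≼-refl ,
    λ y∈ → z≢y (≼-antisym z≼y (proj₂ (∈-interval⁻ y∈)))

  interval-⊂ʳ : ∀ {x y z} → x ≺ z → z ≼ y → interval z y ⊂ interval x y
  interval-⊂ʳ (x≼z , x≢z) z≼y =
    (λ w∈ → let z≼w , w≼y = ∈-interval⁻ w∈ in ∈-interval⁺ (≼-trans x≼z z≼w) w≼y) ,
    _ , ∈-interval⁺ ≼-refl (≼-trans x≼z z≼y) ,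
    λ x∈ → x≢z (≼-antisym x≼z (proj₁ (∈-interval⁻ x∈)))

  ⁅x⁆-⊂-interval : ∀ {x y} → x ≺ y → ⁅ x ⁆ ⊂ interval x y
  ⁅x⁆-⊂-interval {x} (x≼y , x≢y) =
    (λ w∈ → ≡.subst (_∈ interval x _) (sym (x∈⁅y⁆⇒x≡y x w∈)) (∈-interval⁺ ≼-refl x≼y)) ,
    _ , ∈-interval⁺ x≼y ≼-refl , λ y∈ → x≢y (sym (x∈⁅y⁆⇒x≡y x y∈))

  1<∣interval∣ : ∀ {x y} → x ≺ y → 1 < ∣ interval x y ∣
  1<∣interval∣ {x} {y} x≺y = ≡.subst (_< ∣ interval x y ∣) (∣⁅x⁆∣≡1 x) (p⊂q⇒∣p∣<∣q∣ (⁅x⁆-⊂-interval x≺y))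

  ρ-strict : ∀ {x y} → x ≺ y → ρ x < ρ y
  ρ-strict {x} {y} = go (suc ∣ interval x y ∣) ≤-refl
    where
    go : ∀ b {x y} → ∣ interval x y ∣ < b → x ≺ y → ρ x < ρ y
    go (suc b) {x} {y} size< x≺y@(x≼y , x≢y) with any? (λ z → x ≺? z ×-dec z ≺? y)
    ... | yes (z , x≺z , z≺y) =
      <-trans (go b (<-≤-trans (p⊂q⇒∣p∣<∣q∣ (interval-⊂ˡ (proj₁ x≺z) z≺y)) (≤-pred size<)) x≺z)
              (go b (<-≤-trans (p⊂q⇒∣p∣<∣q∣ (interval-⊂ʳ x≺z (proj₁ z≺y))) (≤-pred size<)) z≺y)
    ... | no nothing-between = ℕ.≤-reflexive (sym (ρ-cover x y x≼y x≢y covers))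
      where
      covers : ∀ z → x ≼ z → z ≼ y → z ≡ x ⊎ z ≡ y
      covers z x≼z z≼y with z ≟ x | z ≟ y
      ... | yes z≡x | _       = inj₁ z≡x
      ... | no _    | yes z≡y = inj₂ z≡y
      ... | no z≢x  | no z≢y  = contradiction (z , (x≼z , z≢x ∘ sym) , (z≼y , z≢y)) nothing-between

  ρ-mono : ∀ {x y} → x ≼ y → ρ x ≤ ρ y
  ρ-mono {x} {y} x≼y with x ≟ y
  ... | yes refl = ≤-refl
  ... | no x≢y   = <⇒≤ (ρ-strict (x≼y , x≢y))

  rk-+ : ∀ {x y z} → x ≼ z → z ≼ y → rk P x y ≡ rk P x z + rk P z y
  rk-+ {x} {y} {z} x≼z z≼y = begin
    ρ y ∸ ρ x                 ≡⟨ cong (_∸ ρ x) (m∸n+n≡m (ρ-mono z≼y)) ⟨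
    (ρ y ∸ ρ z) + ρ z ∸ ρ x   ≡⟨ +-∸-assoc (ρ y ∸ ρ z) (ρ-mono x≼z) ⟩
    (ρ y ∸ ρ z) + (ρ z ∸ ρ x) ≡⟨ +-comm (ρ y ∸ ρ z) _ ⟩
    (ρ z ∸ ρ x) + (ρ y ∸ ρ z) ∎
    where open ≡.≡-Reasoning

  rk-pos : ∀ {x y} → x ≺ y → 0 < rk P x y
  rk-pos x≺y = m<n⇒0<n∸m (ρ-strict x≺y)

  rk-refl : ∀ x → rk P x x ≡ 0
  rk-refl x = ℕ.n∸n≡0 (ρ x)

  rk-pos⇒≺ : ∀ {x y} → x ≼ y → 0 < rk P x y → x ≺ y
  rk-pos⇒≺ {x} x≼y 0<rk = x≼y , λ { refl → ℕ.<-irrefl (sym (rk-refl x)) 0<rk }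

  rk-injective : ∀ {x z z′} → x ≼ z → x ≼ z′ → z ≼ z′ ⊎ z′ ≼ z → rk P x z ≡ rk P x z′ → z ≡ z′
  rk-injective {x} {z} {z′} x≼z x≼z′ comparable rk≡ with z ≟ z′
  ... | yes z≡z′ = z≡z′
  ... | no z≢z′  = contradiction ρz≡ρz′ (ρ-distinct comparable)
    where
    ρz≡ρz′ : ρ z ≡ ρ z′
    ρz≡ρz′ = trans (sym (m∸n+n≡m (ρ-mono x≼z))) (trans (cong (_+ ρ x) rk≡) (m∸n+n≡m (ρ-mono x≼z′)))
    ρ-distinct : z ≼ z′ ⊎ z′ ≼ z → ρ z ≢ ρ z′
    ρ-distinct (inj₁ z≼z′) eq = ℕ.<-irrefl eq (ρ-strict (z≼z′ , z≢z′))
    ρ-distinct (inj₂ z′≼z) eq = ℕ.<-irrefl (sym eq) (ρ-strict (z′≼z , z≢z′ ∘ sym))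

module IncidenceMatrices {c ℓ ℓ′ : Level} (F : OrderedField c ℓ ℓ′) {n : ℕ} (P : GradedPoset n) where
  open OrderedField F hiding (_<_)
  open GradedPoset P
  open GradedPosetProperties P
  open Matrices commRing n public
  open Reciprocity matrixRing using (RightCancellable)
  open import Algebra.Properties.Semiring.Sum semiring using (sum)
  open FiniteSums +-commutativeMonoid using (sum-zero; sum-single)
  open import Algebra.Solver.CommutativeMonoid *-commutativeMonoid using (solve; _⊜_; _⊕_)
  open import Algebra.Properties.Ring ring using (-‿distribˡ-*; -‿distribʳ-*; -‿involutive)
  open import Relation.Binary.Reasoning.Setoid setoid

  open Indicators semiring public

  E : Matrix
  E x y = 𝟙 (does (x ≺? y))

  E-≺ : ∀ {x y} → x ≺ y → E x y ≈ 1#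
  E-≺ {x} {y} = 𝟙-yes (x ≺? y)

  strict : Matrix → Matrix
  strict f x y = if does (x ≺? y) then f x y else 0#

  Upper StrictlyUpper : Matrix → Set _
  Upper f = ∀ x y → ¬ x ≼ y → f x y ≈ 0#
  StrictlyUpper f = ∀ x y → ¬ x ≺ y → f x y ≈ 0#

  strict-≺ : ∀ f {x y} → x ≺ y → strict f x y ≈ f x y
  strict-≺ f {x} {y} x≺y = reflexive (if-cong (dec-true (x ≺? y) x≺y))

  strict-strictlyUpper : ∀ f → StrictlyUpper (strict f)
  strict-strictlyUpper f x y x⊀y = reflexive (if-cong (dec-false (x ≺? y) x⊀y))

  strictlyUpper⇒upper : ∀ {f} → StrictlyUpper f → Upper f
  strictlyUpper⇒upper f-su x y x⋠y = f-su x y λ (x≼y , _) → x⋠y x≼y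

  E-strictlyUpper : StrictlyUpper E
  E-strictlyUpper x y = 𝟙-no (x ≺? y)

  scalar-upper : ∀ a → Upper (scalar a)
  scalar-upper a x y x⋠y = trans (*-congˡ (I-off {x} {y} λ { ≡.refl → x⋠y ≼-refl })) (zeroʳ a)

  ⊞-upper : ∀ {f g} → Upper f → Upper g → Upper (f ⊞ g)
  ⊞-upper f-u g-u x y x⋠y = trans (+-cong (f-u x y x⋠y) (g-u x y x⋠y)) (+-identityʳ 0#)

  ⋆-strictlyUpper : ∀ {f g} → Upper f → StrictlyUpper g → StrictlyUpper (f ⋆ g)
  ⋆-strictlyUpper {f} {g} f-u g-su x y x⊀y = sum-zero term≈0
    where
    term≈0 : ∀ z → f x z * g z y ≈ 0#
    term≈0 z with ≼-dec x z | z ≺? y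
    ... | no x⋠z  | _        = trans (*-congʳ (f-u x z x⋠z)) (zeroˡ _)
    ... | yes _   | no z⊀y   = trans (*-congˡ (g-su z y z⊀y)) (zeroʳ _)
    ... | yes x≼z | yes z≺y  = contradiction (≼-≺-trans x≼z z≺y) x⊀y

  unitriangular⇒cancellable : ∀ {b} → Upper b → (∀ x → b x x ≈ 1#) → RightCancellable b
  unitriangular⇒cancellable {b} b-upper b-diag d d⋆b≐𝟘 x y = go (suc (ρ y)) y ℕ.≤-refl
    where
    go : ∀ m y → ρ y < m → d x y ≈ 0#
    go (suc m) y ρy<1+m = begin
      d x y                      ≈⟨ *-identityʳ _ ⟨
      d x y * 1#                 ≈⟨ *-congˡ (b-diag y) ⟨
      d x y * b y y              ≈⟨ sum-single y lower-terms≈0 ⟨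
      sum (λ z → d x z * b z y)  ≈⟨ d⋆b≐𝟘 x y ⟩
      0#                         ∎
      where
      lower-terms≈0 : ∀ z → z ≢ y → d x z * b z y ≈ 0#
      lower-terms≈0 z z≢y with ≼-dec z y
      ... | yes z≼y = trans (*-congʳ (go m z (ℕ.<-≤-trans (ρ-strict (z≼y , z≢y)) (ℕ.≤-pred ρy<1+m)))) (zeroˡ _)
      ... | no z⋠y  = trans (*-congˡ (b-upper z y z⋠y)) (zeroʳ _)

  I⊞strictlyUpper-cancellable : ∀ {f} → StrictlyUpper f → RightCancellable (I ⊞ f)
  I⊞strictlyUpper-cancellable {f} f-su = unitriangular⇒cancellable upper diag
    where
    upper : Upper (I ⊞ f)
    upper = ⊞-upper (λ x y x⋠y → I-off {x} {y} λ { ≡.refl → x⋠y ≼-refl }) (strictlyUpper⇒upper f-su)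
    diag : ∀ x → I x x + f x x ≈ 1#
    diag x = trans (+-cong (I-diag x) (f-su x x ≺-irrefl)) (+-identityʳ 1#)

  sgn-+ : ∀ a b → sgn P F (a ℕ.+ b) ≈ sgn P F a * sgn P F b
  sgn-+ zero    b = sym (*-identityˡ _)
  sgn-+ (suc a) b = trans (-‿cong (sgn-+ a b)) (-‿distribˡ-* _ _)

  sgn² : ∀ a → sgn P F a * sgn P F a ≈ 1#
  sgn² zero    = *-identityˡ 1#
  sgn² (suc a) = begin
    - sgn P F a * - sgn P F a     ≈⟨ -‿distribˡ-* _ _ ⟨
    - (sgn P F a * - sgn P F a)   ≈⟨ -‿cong (-‿distribʳ-* _ _) ⟨
    - - (sgn P F a * sgn P F a)   ≈⟨ -‿involutive _ ⟩
    sgn P F a * sgn P F a         ≈⟨ sgn² a ⟩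
    1#                            ∎

  sgn-even : ∀ j → sgn P F (j ℕ.* 2) ≈ 1#
  sgn-even zero    = refl
  sgn-even (suc j) = trans (-‿involutive _) (sgn-even j)

  open Conjugation (λ x → sgn P F (ρ x)) (λ x → sgn² (ρ x)) public

  conj-≼ : ∀ f {x y} → x ≼ y → conj f x y ≈ sgn P F (rk P x y) * f x y
  conj-≼ f {x} {y} x≼y = begin
    sx * f x y * sgn P F (ρ y)               ≈⟨ *-congˡ (reflexive (≡.cong (sgn P F) (ℕ.m∸n+n≡m (ρ-mono x≼y)))) ⟨
    sx * f x y * sgn P F (rk P x y ℕ.+ ρ x)  ≈⟨ *-congˡ (sgn-+ (rk P x y) (ρ x)) ⟩
    sx * f x y * (sgn P F (rk P x y) * sx)   ≈⟨ solve 3 (λ a b c → (a ⊕ b) ⊕ (c ⊕ a) ⊜ (c ⊕ b) ⊕ (a ⊕ a)) refl sx (f x y) (sgn P F (rk P x y)) ⟩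
    sgn P F (rk P x y) * f x y * (sx * sx)   ≈⟨ *-congˡ (sgn² (ρ x)) ⟩
    sgn P F (rk P x y) * f x y * 1#          ≈⟨ *-identityʳ _ ⟩
    sgn P F (rk P x y) * f x y               ∎
    where
    sx : Carrier
    sx = sgn P F (ρ x)

  conj-strictlyUpper : ∀ {f} → StrictlyUpper f → StrictlyUpper (conj f)
  conj-strictlyUpper f-su x y x⊀y = trans (*-congʳ (trans (*-congˡ (f-su x y x⊀y)) (zeroʳ _))) (zeroˡ _)

  conj-E-≺ : ∀ {x y} → x ≺ y → conj E x y ≈ sgn P F (rk P x y)
  conj-E-≺ x≺y@(x≼y , _) = trans (conj-≼ E x≼y) (trans (*-congˡ (E-≺ x≺y)) (*-identityʳ _))

module ListSums {c ℓ ℓ′ : Level} (F : OrderedField c ℓ ℓ′) {n : ℕ} (P : GradedPoset n) where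
  open OrderedField F hiding (_<_)
  open IncidenceMatrices F P using (𝟙)
  open import Algebra.Properties.Semiring.Sum semiring using (sum)
  open FiniteSums +-commutativeMonoid using (∑ₛ)
  open List using (List; []; _∷_; _++_)

  sumF-tabulate : ∀ {m} (g : Fin m → Fin n) f → sumF P F (List.tabulate g) f ≈ sum (f ∘ g)
  sumF-tabulate {zero}  g f = refl
  sumF-tabulate {suc m} g f = +-congˡ (sumF-tabulate (g ∘ suc) f)

  sumF-elems : ∀ f → sumF P F (elems P) f ≈ sum f
  sumF-elems = sumF-tabulate id

  sumF-++ : ∀ {A : Set} (xs ys : List A) f → sumF P F (xs ++ ys) f ≈ sumF P F xs f + sumF P F ys f
  sumF-++ []       ys f = sym (+-identityˡ _)
  sumF-++ (a ∷ xs) ys f = trans (+-congˡ (sumF-++ xs ys f)) (sym (+-assoc _ _ _))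

  sumF-map : ∀ {A B : Set} (g : A → B) xs f → sumF P F (List.map g xs) f ≡ sumF P F xs (f ∘ g)
  sumF-map g []       f = ≡.refl
  sumF-map g (a ∷ xs) f = ≡.cong (f (g a) +_) (sumF-map g xs f)

  sumF-allSubsets : ∀ m f → sumF P F (allSubsets m) f ≈ ∑ₛ m f
  sumF-allSubsets zero    f = +-identityʳ _
  sumF-allSubsets (suc m) f = trans (sumF-++ (List.map (true ∷_) (allSubsets m)) _ f)
    (+-cong (trans (reflexive (sumF-map (true ∷_) (allSubsets m) f)) (sumF-allSubsets m _))
            (trans (reflexive (sumF-map (false ∷_) (allSubsets m) f)) (sumF-allSubsets m _)))

  ℕ→F-count : ∀ {A : Set} (p : A → Bool) xs → ℕ→F P F (count p xs) ≈ sumF P F xs (𝟙 ∘ p)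
  ℕ→F-count p []       = refl
  ℕ→F-count p (a ∷ xs) with p a
  ... | true  = +-congˡ (ℕ→F-count p xs)
  ... | false = trans (ℕ→F-count p xs) (sym (+-identityˡ _))

module KMöbius {c ℓ ℓ′ : Level} (F : OrderedField c ℓ ℓ′) {n : ℕ} (P : GradedPoset n) (k : OrderedField.Carrier F) where
  open OrderedField F hiding (_<_)
  open GradedPoset P
  open GradedPosetProperties P
  open IncidenceMatrices F P
  open ListSums F P using (sumF-elems)
  open import Algebra.Properties.Semiring.Sum semiring using (sum-cong-≋)
  open import Algebra.Properties.Ring ring using (//-rightDividesˡ; -0#≈0#)
  open import Data.Bool.Properties using (∧-assoc)
  open import Data.Fin.Subset.Properties using (∣p∣≤n)
  open import Relation.Binary.Reasoning.Setoid setoid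

  μ : Matrix
  μ = μₖ P F k

  ν : Matrix
  ν = strict μ

  -- `does (between? x y z)` is the guard in the recursive clause of Defs' `μfuel`.
  between? : ∀ x y z → Dec (x ≼ z × x ≢ z × z ≼ y × z ≢ y)
  between? x y z = x ≼? z ×-dec ¬? (x ≟ z) ×-dec z ≼? y ×-dec ¬? (z ≟ y)

  recursion-sum : ℕ → Fin n → Fin n → Carrier
  recursion-sum d x y = sumF P F (elems P) λ z → if does (between? x y z) then μfuel P F k d x z else 0#

  =ᵇ-false⇒≢ : ∀ {x y} → _=ᵇ_ P F x y ≡ false → x ≢ y
  =ᵇ-false⇒≢ {x} eq ≡.refl with () ← ≡.trans (≡.sym eq) (dec-true (x ≟ x) ≡.refl)

  n≡suc : Fin n → n ≡ suc (ℕ.pred n)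
  n≡suc zero    = ≡.refl
  n≡suc (suc _) = ≡.refl

  μfuel-suc : ∀ d {x y} → x ≢ y → μfuel P F k (suc d) x y ≡ - 1# - k ⁻¹ * recursion-sum d x y
  μfuel-suc d {x} {y} x≢y with _=ᵇ_ P F x y in eq
  ... | false = ≡.refl
  ... | true  = contradiction (witness (x ≟ y) eq) x≢y

  μ-diag : ∀ x → μ x x ≈ 1#
  μ-diag x with _=ᵇ_ P F x x in eq
  ... | true  = refl
  ... | false = contradiction ≡.refl (=ᵇ-false⇒≢ {x} eq)

  -- μₖ is computed with fuel n, while its defining recursion calls fuel n - 1;
  -- once the fuel reaches the size of the interval it no longer changes the value.
  μfuel-stable : ∀ d {x y} → x ≼ y → ∣ interval x y ∣ ≤ suc d → μfuel P F k (suc d) x y ≈ μfuel P F k d x y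
  μfuel-stable d {x} {y} x≼y size≤ with _=ᵇ_ P F x y in eq
  ... | true = refl
  μfuel-stable zero    {x} {y} x≼y size≤ | false =
    contradiction (ℕ.<-≤-trans (1<∣interval∣ (x≼y , =ᵇ-false⇒≢ {x} eq)) size≤) (ℕ.<-irrefl ≡.refl)
  μfuel-stable (suc d) {x} {y} x≼y size≤ | false =
    +-congˡ (-‿cong (*-congˡ (trans (sumF-elems _) (trans (sum-cong-≋ {n} λ z →
      if-does-cong (between? x y z) λ (x≼z , x≢z , z≼y , z≢y) →
        μfuel-stable d x≼z (ℕ.≤-pred (ℕ.<-≤-trans (p⊂q⇒∣p∣<∣q∣ (interval-⊂ˡ x≼z (z≼y , z≢y))) size≤)))
      (sym (sumF-elems _))))))

  μ≈μfuel-pred : ∀ {x z} → x ≼ z → μ x z ≈ μfuel P F k (ℕ.pred n) x z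
  μ≈μfuel-pred {x} {z} x≼z = begin
    μfuel P F k n x z                  ≡⟨ ≡.cong (λ m → μfuel P F k m x z) (n≡suc x) ⟩
    μfuel P F k (suc (ℕ.pred n)) x z   ≈⟨ μfuel-stable (ℕ.pred n) x≼z (≡.subst (∣ interval x z ∣ ≤_) (n≡suc x) (∣p∣≤n (interval x z))) ⟩
    μfuel P F k (ℕ.pred n) x z         ∎

  recursion-sum≈ν⋆E : ∀ x y → recursion-sum (ℕ.pred n) x y ≈ (ν ⋆ E) x y
  recursion-sum≈ν⋆E x y = trans (sumF-elems _) (sum-cong-≋ {n} term≈)
    where
    term≈ : ∀ z → (if does (between? x y z) then μfuel P F k (ℕ.pred n) x z else 0#) ≈ ν x z * E z y
    term≈ z = begin
      (if does (between? x y z) then μfuel P F k (ℕ.pred n) x z else 0#)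
        ≡⟨ if-cong (≡.sym (∧-assoc (_≼ᵇ_ P x z) _ _)) ⟩
      (if does (x ≺? z) ∧ does (z ≺? y) then μfuel P F k (ℕ.pred n) x z else 0#)
        ≈⟨ if-∧≈* (does (x ≺? z)) (does (z ≺? y)) _ ⟩
      (if does (x ≺? z) then μfuel P F k (ℕ.pred n) x z else 0#) * E z y
        ≈⟨ *-congʳ (if-does-cong (x ≺? z) λ (x≼z , _) → sym (μ≈μfuel-pred x≼z)) ⟩
      ν x z * E z y ∎

  μ-recursion : ∀ {x y} → x ≺ y → μ x y ≈ - 1# - k ⁻¹ * (ν ⋆ E) x y
  μ-recursion {x} {y} (x≼y , x≢y) = begin
    μfuel P F k n x y                          ≡⟨ ≡.cong (λ m → μfuel P F k m x y) (n≡suc x) ⟩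
    μfuel P F k (suc (ℕ.pred n)) x y           ≡⟨ μfuel-suc (ℕ.pred n) x≢y ⟩
    - 1# - k ⁻¹ * recursion-sum (ℕ.pred n) x y ≈⟨ +-congˡ (-‿cong (*-congˡ (recursion-sum≈ν⋆E x y))) ⟩
    - 1# - k ⁻¹ * (ν ⋆ E) x y                  ∎

  ν⋆D≐⊟E : ∀ q → k ⁻¹ ≈ q + q → ν ⋆ (I ⊞ (scalar q ⊞ scalar q) ⋆ E) ≐ ⊟ E
  ν⋆D≐⊟E q k⁻¹≈q+q x y = begin
    (ν ⋆ (I ⊞ (scalar q ⊞ scalar q) ⋆ E)) x y ≈⟨ ⋆-cong {ν} {ν} (λ _ _ → refl) D≐ x y ⟩
    (ν ⋆ (I ⊞ scalar (q + q) ⋆ E)) x y        ≈⟨ ⋆-I⊞scalar (q + q) ν E x y ⟩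
    ν x y + (q + q) * (ν ⋆ E) x y             ≈⟨ +-congˡ (*-congʳ k⁻¹≈q+q) ⟨
    ν x y + k ⁻¹ * (ν ⋆ E) x y                ≈⟨ by-cases (x ≺? y) ⟩
    - E x y                                   ∎
    where
    D≐ : I ⊞ (scalar q ⊞ scalar q) ⋆ E ≐ I ⊞ scalar (q + q) ⋆ E
    D≐ u v = +-congˡ (⋆-cong {scalar q ⊞ scalar q} {scalar (q + q)} {E} {E} (scalar-+ q q) (λ _ _ → refl) u v)
    by-cases : Dec (x ≺ y) → ν x y + k ⁻¹ * (ν ⋆ E) x y ≈ - E x y
    by-cases (yes x≺y) = begin
      ν x y + k ⁻¹ * (ν ⋆ E) x y                      ≈⟨ +-congʳ (trans (strict-≺ μ x≺y) (μ-recursion x≺y)) ⟩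
      - 1# - k ⁻¹ * (ν ⋆ E) x y + k ⁻¹ * (ν ⋆ E) x y  ≈⟨ //-rightDividesˡ _ _ ⟩
      - 1#                                            ≈⟨ -‿cong (E-≺ x≺y) ⟨
      - E x y                                         ∎
    by-cases (no x⊀y) = begin
      ν x y + k ⁻¹ * (ν ⋆ E) x y  ≈⟨ +-cong (strict-strictlyUpper μ x y x⊀y) (*-congˡ ν⋆E≈0) ⟩
      0# + k ⁻¹ * 0#              ≈⟨ trans (+-identityˡ _) (zeroʳ _) ⟩
      0#                          ≈⟨ -0#≈0# ⟨
      - 0#                        ≈⟨ -‿cong (E-strictlyUpper x y x⊀y) ⟨
      - E x y                     ∎
      where
      ν⋆E≈0 : (ν ⋆ E) x y ≈ 0#
      ν⋆E≈0 = ⋆-strictlyUpper (strictlyUpper⇒upper (strict-strictlyUpper μ)) E-strictlyUpper x y x⊀y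

  isKEulerian⇔ν≐conjE : IsKEulerian P F k ⇔ ν ≐ conj E
  isKEulerian⇔ν≐conjE = mk⇔ to from
    where
    to : IsKEulerian P F k → ν ≐ conj E
    to eulerian x y with x ≺? y
    ... | yes x≺y@(x≼y , _) = trans (strict-≺ μ x≺y) (trans (eulerian x y x≼y) (sym (conj-E-≺ x≺y)))
    ... | no x⊀y = trans (strict-strictlyUpper μ x y x⊀y) (sym (conj-strictlyUpper E-strictlyUpper x y x⊀y))
    from : ν ≐ conj E → IsKEulerian P F k
    from ν≐conjE x y x≼y with x ≟ y
    ... | yes ≡.refl = trans (μ-diag x) (reflexive (≡.cong (sgn P F) (≡.sym (rk-refl x))))
    ... | no x≢y = trans (sym (strict-≺ μ (x≼y , x≢y))) (trans (ν≐conjE x y) (conj-E-≺ (x≼y , x≢y)))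

module _ {m : ℕ} where

  infix 4 _∈_ _∈?_
  _∈_ : Fin m → Vec Bool m → Set
  z ∈ C = T (lookup C z)

  _∈?_ : ∀ z C → Dec (z ∈ C)
  z ∈? C = T? (lookup C z)

  Vec-ext : ∀ {A : Set} {u v : Vec A m} → (∀ i → lookup u i ≡ lookup v i) → u ≡ v
  Vec-ext {u = u} {v} u≗v =
    ≡.trans (≡.sym (tabulate∘lookup u)) (≡.trans (tabulate-cong u≗v) (tabulate∘lookup v))

  ∈-insert : ∀ z (C : Vec Bool m) → z ∈ C [ z ]≔ true
  ∈-insert z C = ≡.subst T (≡.sym (lookup∘update z C true)) tt

  ∈-insert⁺ : ∀ {z w} (C : Vec Bool m) → w ∈ C → w ∈ C [ z ]≔ true
  ∈-insert⁺ {z} {w} C w∈C with w Fin.≟ z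
  ... | yes ≡.refl = ∈-insert z C
  ... | no w≢z     = ≡.subst T (≡.sym (lookup∘update′ w≢z C true)) w∈C

  ∈-insert⁻ : ∀ {z w} (C : Vec Bool m) → w ∈ C [ z ]≔ true → w ≡ z ⊎ w ∈ C
  ∈-insert⁻ {z} {w} C w∈C′ with w Fin.≟ z
  ... | yes w≡z = inj₁ w≡z
  ... | no w≢z  = inj₂ (≡.subst T (lookup∘update′ w≢z C true) w∈C′)

card-empty : ∀ {m} (C : Vec Bool m) → (∀ i → ¬ i ∈ C) → card C ≡ 0
card-empty []          _    = ≡.refl
card-empty (true  ∷ C) none = contradiction tt (none zero)
card-empty (false ∷ C) none = card-empty C (none ∘ suc)

module ℕ-Sum = Algebra.Properties.Semiring.Sum ℕ.+-*-semiring
module ℕ-𝟙 = Indicators ℕ.+-*-semiring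

card≡sum : ∀ {m} (C : Vec Bool m) → card C ≡ ℕ-Sum.sum (ℕ-𝟙.𝟙 ∘ lookup C)
card≡sum []          = ≡.refl
card≡sum (true  ∷ C) = ≡.cong suc (card≡sum C)
card≡sum (false ∷ C) = card≡sum C

card-insert : ∀ {m} (C : Vec Bool m) z → ¬ z ∈ C → card (C [ z ]≔ true) ≡ suc (card C)
card-insert (true  ∷ C) zero    z∉C = contradiction tt z∉C
card-insert (false ∷ C) zero    _   = ≡.refl
card-insert (true  ∷ C) (suc z) z∉C = ≡.cong suc (card-insert C z z∉C)
card-insert (false ∷ C) (suc z) z∉C = card-insert C z z∉C

module Chains {n : ℕ} (P : GradedPoset n) where
  open GradedPoset P
  open GradedPosetProperties P

  IsChain : Vec Bool n → Set
  IsChain C = ∀ z w → z ∈ C → w ∈ C → z ≼ w ⊎ w ≼ z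

  OpenChain : Fin n → Fin n → Vec Bool n → Set
  OpenChain x y C = (∀ z → z ∈ C → x ≺ z × z ≺ y) × IsChain C

  openChain? : ∀ x y C → Dec (OpenChain x y C)
  openChain? x y C = all? (λ z → z ∈? C →-dec x ≺? z ×-dec z ≺? y)
                   ×-dec all? λ z → all? λ w → z ∈? C →-dec w ∈? C →-dec (z ≼? w ⊎-dec w ≼? z)

  IsTop : Fin n → Vec Bool n → Set
  IsTop t C = ∀ w → w ∈ C → w ≼ t

  isTop? : ∀ t C → Dec (IsTop t C)
  isTop? t C = all? λ w → w ∈? C →-dec w ≼? t

  top-unique : ∀ {C t t′} → t ∈ C → IsTop t C → t′ ∈ C → IsTop t′ C → t ≡ t′
  top-unique t∈C t-top t′∈C t′-top = ≼-antisym (t′-top _ t∈C) (t-top _ t′∈C)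

  HasTop : Vec Bool n → Set
  HasTop C = ∃ λ t → t ∈ C × IsTop t C

  hasTop? : ∀ C → Dec (HasTop C)
  hasTop? C = any? λ t → t ∈? C ×-dec isTop? t C

  top-exists : ∀ {C z} → IsChain C → z ∈ C → HasTop C
  top-exists {C} {z} chain = go (suc ∣ interval z top ∣) ℕ.≤-refl
    where
    go : ∀ b {z} → ∣ interval z top ∣ < b → z ∈ C → HasTop C
    go (suc b) {z} size< z∈C with isTop? z C
    ... | yes z-top = z , z∈C , z-top
    ... | no ¬z-top with ¬∀⟶∃¬ n _ (λ w → w ∈? C →-dec w ≼? z) ¬z-top
    ...   | w , ¬[w∈C⇒w≼z] with w ∈? C
    ...     | no w∉C = contradiction (λ w∈C → contradiction w∈C w∉C) ¬[w∈C⇒w≼z]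
    ...     | yes w∈C with chain z w z∈C w∈C
    ...       | inj₂ w≼z = contradiction (λ _ → w≼z) ¬[w∈C⇒w≼z]
    ...       | inj₁ z≼w = go b (ℕ.<-≤-trans (p⊂q⇒∣p∣<∣q∣ (interval-⊂ʳ z≺w (top-max w))) (ℕ.≤-pred size<)) w∈C
      where
      z≺w : z ≺ w
      z≺w = z≼w , λ { ≡.refl → ¬[w∈C⇒w≼z] (λ _ → ≼-refl) }

  Empty : Vec Bool n → Set
  Empty C = ∀ z → ¬ z ∈ C

  empty? : ∀ C → Dec (Empty C)
  empty? C = all? λ z → ¬? (z ∈? C)

  empty⇒openChain : ∀ {x y C} → Empty C → OpenChain x y C
  empty⇒openChain none = (λ z z∈C → contradiction z∈C (none z)) , λ z _ z∈C → contradiction z∈C (none z)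

  insert-top⇔ : ∀ {x y z} C → ¬ z ∈ C →
                (IsTop z (C [ z ]≔ true) × OpenChain x y (C [ z ]≔ true)) ⇔ ((x ≺ z × z ≺ y) × OpenChain x z C)
  insert-top⇔ {x} {y} {z} C z∉C = mk⇔ to from
    where
    C′ : Vec Bool n
    C′ = C [ z ]≔ true
    to : IsTop z C′ × OpenChain x y C′ → (x ≺ z × z ≺ y) × OpenChain x z C
    to (z-top , inside′ , chain′) =
      inside′ z (∈-insert z C) ,
      (λ w w∈C → proj₁ (inside′ w (∈-insert⁺ C w∈C)) , z-top w (∈-insert⁺ C w∈C) , λ { ≡.refl → z∉C w∈C }) ,
      (λ w v w∈C v∈C → chain′ w v (∈-insert⁺ C w∈C) (∈-insert⁺ C v∈C))
    from : (x ≺ z × z ≺ y) × OpenChain x z C → IsTop z C′ × OpenChain x y C′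
    from (x≺z×z≺y@(_ , z≺y) , inside , chain) = z-top , inside′ , chain′
      where
      z-top : IsTop z C′
      z-top w w∈C′ with ∈-insert⁻ C w∈C′
      ... | inj₁ ≡.refl = ≼-refl
      ... | inj₂ w∈C    = proj₁ (proj₂ (inside w w∈C))
      inside′ : ∀ w → w ∈ C′ → x ≺ w × w ≺ y
      inside′ w w∈C′ with ∈-insert⁻ C w∈C′
      ... | inj₁ ≡.refl = x≺z×z≺y
      ... | inj₂ w∈C    = let x≺w , w≺z = inside w w∈C in x≺w , ≺-trans w≺z z≺y
      chain′ : IsChain C′
      chain′ w v w∈C′ v∈C′ with ∈-insert⁻ C w∈C′ | ∈-insert⁻ C v∈C′
      ... | inj₁ ≡.refl | _           = inj₂ (z-top v v∈C′)
      ... | inj₂ _      | inj₁ ≡.refl = inj₁ (z-top w w∈C′)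
      ... | inj₂ w∈C    | inj₂ v∈C    = chain w v w∈C v∈C

  ¬openChain-to-member : ∀ {x z C} → z ∈ C → ¬ OpenChain x z C
  ¬openChain-to-member z∈C (inside , _) = ≺-irrefl (proj₂ (inside _ z∈C))

  module RankSets (x y : Fin n) where

    m : ℕ
    m = rk P x y ∸ 1

    ChainWithRanks : Vec Bool m → Vec Bool n → Set
    ChainWithRanks T C =
        (∀ z → z ∈ C → x ≼ z × z ≼ y)
      × (∀ z w → z ∈ C × w ∈ C → z ≼ w ⊎ w ≼ z)
      × (∀ z → z ∈ C → ∃ λ i → i ∈ T × rk P x z ≡ suc (toℕ i))
      × (∀ i → i ∈ T → ∃ λ z → z ∈ C × rk P x z ≡ suc (toℕ i))

    -- `does (chainWithRanks? T C)` is, definitionally, Defs' `isChainWithRanks P x y T C`.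
    chainWithRanks? : ∀ T C → Dec (ChainWithRanks T C)
    chainWithRanks? T C =
            all-tabulate? (λ z → z ∈? C →-dec x ≼? z ×-dec z ≼? y) id
      ×-dec all-tabulate? (λ z → all-tabulate? (λ w → (z ∈? C ×-dec w ∈? C) →-dec (z ≼? w ⊎-dec w ≼? z)) id) id
      ×-dec all-tabulate? (λ z → z ∈? C →-dec any-tabulate? (λ i → i ∈? T ×-dec rk P x z ℕ.≟ suc (toℕ i)) id) id
      ×-dec all-tabulate? (λ i → i ∈? T →-dec any-tabulate? (λ z → z ∈? C ×-dec rk P x z ℕ.≟ suc (toℕ i)) id) id

    HasRank : Vec Bool n → Fin m → Fin n → Set
    HasRank C i z = z ∈ C × rk P x z ≡ suc (toℕ i)

    hasRank? : ∀ C i z → Dec (HasRank C i z)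
    hasRank? C i z = z ∈? C ×-dec rk P x z ℕ.≟ suc (toℕ i)

    ranks : Vec Bool n → Vec Bool m
    ranks C = tabulate λ i → does (any? (hasRank? C i))

    ∈-ranks⇔ : ∀ {C i} → i ∈ ranks C ⇔ (∃ λ z → HasRank C i z)
    ∈-ranks⇔ {C} {i} = mk⇔
      (λ i∈ → witness (any? (hasRank? C i)) (≡.trans (≡.sym (lookup∘tabulate _ i)) (Equivalence.to T-≡ i∈)))
      (λ ∃z → Equivalence.from T-≡ (≡.trans (lookup∘tabulate _ i) (dec-true (any? (hasRank? C i)) ∃z)))

    rank-index : ∀ {z} → x ≺ z → z ≺ y → ∃ λ (i : Fin m) → rk P x z ≡ suc (toℕ i)
    rank-index {z} x≺z z≺y = Fin.fromℕ< r∸1<m , ≡.sym (≡.trans (≡.cong suc (toℕ-fromℕ< r∸1<m)) (suc-∸1 (rk-pos x≺z)))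
      where
      r<rk : rk P x z < rk P x y
      r<rk = ≡.subst (rk P x z <_) (≡.sym (rk-+ (proj₁ x≺z) (proj₁ z≺y))) (ℕ.m<m+n (rk P x z) (rk-pos z≺y))
      r∸1<m : rk P x z ∸ 1 < m
      r∸1<m = ℕ.∸-monoˡ-< r<rk (rk-pos x≺z)
      suc-∸1 : ∀ {r} → 0 < r → suc (r ∸ 1) ≡ r
      suc-∸1 {suc r} _ = ≡.refl

    card-ranks : ∀ {C} → OpenChain x y C → card (ranks C) ≡ card C
    card-ranks {C} (inside , chain) = begin
      card (ranks C)                                          ≡⟨ card≡sum (ranks C) ⟩
      sum (𝟙 ∘ lookup (ranks C))                              ≡⟨ sum-cong-≗ {m} (λ i → ≡.cong 𝟙 (lookup∘tabulate _ i)) ⟩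
      sum (λ i → 𝟙 (does (any? (hasRank? C i))))              ≡⟨ sum-cong-≗ {m} (λ i → 𝟙-any≈sum (hasRank? C i) unique-element) ⟩
      sum (λ i → sum (λ z → 𝟙 (does (hasRank? C i z))))       ≡⟨ ∑-comm {m} {n} _ ⟩
      sum (λ z → sum (λ i → 𝟙 (does (hasRank? C i z))))       ≡⟨ sum-cong-≗ {n} (λ z → 𝟙-any≈sum (λ i → hasRank? C i z) unique-rank) ⟨
      sum (λ z → 𝟙 (does (any? (λ i → hasRank? C i z))))      ≡⟨ sum-cong-≗ {n} (λ z → ≡.cong 𝟙 (does-⇔ has-rank⇔∈ (any? (λ i → hasRank? C i z)) (z ∈? C))) ⟩
      sum (𝟙 ∘ lookup C)                                      ≡⟨ card≡sum C ⟨
      card C                                                  ∎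
      where
      open ℕ-Sum using (sum; sum-cong-≗; ∑-comm)
      open ℕ-𝟙 using (𝟙; 𝟙-any≈sum)
      open ≡.≡-Reasoning
      unique-element : ∀ {i z z′} → HasRank C i z → HasRank C i z′ → z ≡ z′
      unique-element (z∈C , rk≡) (z′∈C , rk≡′) =
        rk-injective (proj₁ (proj₁ (inside _ z∈C))) (proj₁ (proj₁ (inside _ z′∈C))) (chain _ _ z∈C z′∈C) (≡.trans rk≡ (≡.sym rk≡′))
      unique-rank : ∀ {z i j} → HasRank C i z → HasRank C j z → i ≡ j
      unique-rank (_ , rk≡) (_ , rk≡′) = toℕ-injective (ℕ.suc-injective (≡.trans (≡.sym rk≡) rk≡′))
      has-rank⇔∈ : ∀ {z} → (∃ λ i → HasRank C i z) ⇔ z ∈ C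
      has-rank⇔∈ = mk⇔ (proj₁ ∘ proj₂) λ z∈C → let i , rk≡ = rank-index (proj₁ (inside _ z∈C)) (proj₂ (inside _ z∈C)) in i , z∈C , rk≡

    chainWithRanks⇒openChain : ∀ {T C} → ChainWithRanks T C → OpenChain x y C
    chainWithRanks⇒openChain (bounds , comparable , has-rank , _) = inside , λ z w z∈C w∈C → comparable z w (z∈C , w∈C)
      where
      inside : ∀ z → _ → x ≺ z × z ≺ y
      inside z z∈C with bounds z z∈C | has-rank z z∈C
      ... | x≼z , z≼y | i , _ , rk≡ =
        (x≼z , λ { ≡.refl → ℕ.0≢1+n (≡.trans (≡.sym (rk-refl x)) rk≡) }) ,
        (z≼y , λ { ≡.refl → ℕ.<-irrefl ≡.refl (≡.subst (λ r → toℕ i < r ∸ 1) rk≡ (toℕ<n i)) })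

    chainWithRanks⇒≡ranks : ∀ {T C} → ChainWithRanks T C → T ≡ ranks C
    chainWithRanks⇒≡ranks {T} {C} (_ , _ , has-rank , realised) = Vec-ext λ i →
      ≡.trans (does-⇔ (i∈T⇔ i) (i ∈? T) (any? (hasRank? C i))) (≡.sym (lookup∘tabulate _ i))
      where
      i∈T⇔ : ∀ i → i ∈ T ⇔ (∃ λ z → HasRank C i z)
      i∈T⇔ i = mk⇔ (realised i) λ (z , z∈C , rk≡) →
        let j , j∈T , rk≡′ = has-rank z z∈C
        in ≡.subst (_∈ T) (toℕ-injective (ℕ.suc-injective (≡.trans (≡.sym rk≡′) rk≡))) j∈T

    openChain⇒chainWithRanks : ∀ {C} → OpenChain x y C → ChainWithRanks (ranks C) C
    openChain⇒chainWithRanks {C} (inside , chain) =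
      (λ z z∈C → let (x≼z , _) , (z≼y , _) = inside z z∈C in x≼z , z≼y) ,
      (λ z w (z∈C , w∈C) → chain z w z∈C w∈C) ,
      (λ z z∈C → let i , rk≡ = rank-index (proj₁ (inside z z∈C)) (proj₂ (inside z z∈C))
                 in i , Equivalence.from (∈-ranks⇔ {C}) (z , z∈C , rk≡) , rk≡) ,
      (λ i i∈ → Equivalence.to (∈-ranks⇔ {C}) i∈)

module ChainSums {c ℓ ℓ′ : Level} (F : OrderedField c ℓ ℓ′) {n : ℕ} (P : GradedPoset n) where
  open OrderedField F hiding (_<_)
  open GradedPosetProperties P
  open IncidenceMatrices F P
  open import Algebra.Properties.Semiring.Sum semiring using (sum; sum-cong-≋; *-distribˡ-sum; *-distribʳ-sum)
  open FiniteSums +-commutativeMonoid using (∑ₛ; ∑ₛ-cong; ∑ₛ-zero; ∑ₛ-distrib; ∑ₛ-single; ∑ₛ-insert; ∑ₛ-sum-comm; ∑ₛ-comm)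
  open SemiringSums semiring using (*-distribˡ-∑ₛ)
  open import Algebra.Solver.CommutativeMonoid *-commutativeMonoid using (solve; _⊜_; _⊕_)
  open Chains P
  open ListSums F P using (sumF-allSubsets; ℕ→F-count)
  open import Relation.Binary.Reasoning.Setoid setoid

  ∑ₛ-𝟙-empty : ∑ₛ n (𝟙 ∘ does ∘ empty?) ≈ 1#
  ∑ₛ-𝟙-empty = trans (∑ₛ-single n ∅ λ C C≢∅ → 𝟙-no (empty? C) (C≢∅ ∘ empty⇒≡∅))
                     (𝟙-yes (empty? ∅) λ z z∈∅ → ≡.subst T (lookup-replicate z false) z∈∅)
    where
    ∅ : Vec Bool n
    ∅ = replicate n false
    empty⇒≡∅ : ∀ {C} → Empty C → C ≡ ∅
    empty⇒≡∅ {C} none = Vec-ext λ z → ≡.trans (¬T⇒≡false (none z)) (≡.sym (lookup-replicate z false))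
      where
      ¬T⇒≡false : ∀ {b} → ¬ T b → b ≡ false
      ¬T⇒≡false {false} _  = ≡.refl
      ¬T⇒≡false {true}  ¬t = contradiction tt ¬t

  sum-over-tops : ∀ C v → sum (λ z → if lookup C z then 𝟙 (does (isTop? z C)) * v else 0#) ≈ 𝟙 (does (hasTop? C)) * v
  sum-over-tops C v = begin
    sum (λ z → if lookup C z then 𝟙 (does (isTop? z C)) * v else 0#)
      ≈⟨ sum-cong-≋ {n} (λ z → trans (if≈𝟙* (lookup C z)) (trans (sym (*-assoc _ _ _)) (*-congʳ (sym (𝟙-∧ (lookup C z) _))))) ⟩
    sum (λ z → 𝟙 (does (z ∈? C ×-dec isTop? z C)) * v)
      ≈⟨ *-distribʳ-sum v (λ z → 𝟙 (does (z ∈? C ×-dec isTop? z C))) ⟨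
    sum (λ z → 𝟙 (does (z ∈? C ×-dec isTop? z C))) * v
      ≈⟨ *-congʳ (𝟙-any≈sum (λ z → z ∈? C ×-dec isTop? z C) λ (t∈C , t-top) (t′∈C , t′-top) → top-unique {C} t∈C t-top t′∈C t′-top) ⟨
    𝟙 (does (hasTop? C)) * v ∎

  card-fullSet : ∀ m → card (fullSet P F m) ≡ m
  card-fullSet zero    = ≡.refl
  card-fullSet (suc m) = ≡.cong suc (card-fullSet m)

  complSub-fullSet : ∀ m T → complSub P F (fullSet P F m) T ≡ true
  complSub-fullSet zero    []      = ≡.refl
  complSub-fullSet (suc m) (_ ∷ T) = complSub-fullSet m T

  module Weighted (w : Carrier) where

    chainWeight : Fin n → Fin n → Vec Bool n → Carrier
    chainWeight x y C = 𝟙 (does (openChain? x y C)) * pow P F w (card C)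

    chainSum : Matrix
    chainSum x y = ∑ₛ n (chainWeight x y)

    h : Matrix
    h = strict chainSum

    chainWeight-by-top : ∀ x y C → chainWeight x y C ≈ 𝟙 (does (empty? C)) + 𝟙 (does (hasTop? C)) * chainWeight x y C
    chainWeight-by-top x y C = by-cases (openChain? x y C) (empty? C)
      where
      by-cases : Dec (OpenChain x y C) → Dec (Empty C) →
                 chainWeight x y C ≈ 𝟙 (does (empty? C)) + 𝟙 (does (hasTop? C)) * chainWeight x y C
      by-cases (no ¬oc) _ = begin
        chainWeight x y C                                      ≈⟨ cw≈0 ⟩
        0#                                                     ≈⟨ +-identityʳ 0# ⟨
        0# + 0#                                                ≈⟨ +-cong (𝟙-no (empty? C) (¬oc ∘ empty⇒openChain {C = C})) (trans (*-congˡ cw≈0) (zeroʳ _)) ⟨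
        𝟙 (does (empty? C)) + 𝟙 (does (hasTop? C)) * chainWeight x y C ∎
        where
        cw≈0 : chainWeight x y C ≈ 0#
        cw≈0 = trans (*-congʳ (𝟙-no (openChain? x y C) ¬oc)) (zeroˡ _)
      by-cases (yes oc) (yes none) = begin
        chainWeight x y C                                      ≈⟨ *-cong (𝟙-yes (openChain? x y C) oc) (reflexive (≡.cong (pow P F w) (card-empty C none))) ⟩
        1# * 1#                                                ≈⟨ *-identityˡ 1# ⟩
        1#                                                     ≈⟨ +-identityʳ 1# ⟨
        1# + 0#                                                ≈⟨ +-cong (𝟙-yes (empty? C) none) (trans (*-congʳ (𝟙-no (hasTop? C) λ (z , z∈C , _) → none z z∈C)) (zeroˡ _)) ⟨
        𝟙 (does (empty? C)) + 𝟙 (does (hasTop? C)) * chainWeight x y C ∎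
      by-cases (yes (_ , chain)) (no ¬none) = begin
        chainWeight x y C                                      ≈⟨ *-identityˡ _ ⟨
        1# * chainWeight x y C                                 ≈⟨ +-identityˡ _ ⟨
        0# + 1# * chainWeight x y C                            ≈⟨ +-cong (𝟙-no (empty? C) ¬none) (*-congʳ (𝟙-yes (hasTop? C) (top-exists {C} chain (proj₂ member)))) ⟨
        𝟙 (does (empty? C)) + 𝟙 (does (hasTop? C)) * chainWeight x y C ∎
        where
        member : ∃ λ z → z ∈ C
        member with ¬∀⟶∃¬ n _ (λ z → ¬? (z ∈? C)) ¬none
        ... | z , ¬z∉C with z ∈? C
        ...   | yes z∈C = z , z∈C
        ...   | no z∉C  = contradiction z∉C ¬z∉C

    inserted-term : ∀ x y z C →
      (if lookup C z then 0# else 𝟙 (does (isTop? z (C [ z ]≔ true))) * chainWeight x y (C [ z ]≔ true))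
      ≈ 𝟙 (does (x ≺? z ×-dec z ≺? y)) * (w * chainWeight x z C)
    inserted-term x y z C with z ∈? C
    ... | yes z∈C = trans (reflexive (if-cong (dec-true (z ∈? C) z∈C))) (begin
      0#                                                           ≈⟨ zeroʳ _ ⟨
      𝟙 (does (x ≺? z ×-dec z ≺? y)) * 0#                          ≈⟨ *-congˡ (trans (*-congˡ cw≈0) (zeroʳ w)) ⟨
      𝟙 (does (x ≺? z ×-dec z ≺? y)) * (w * chainWeight x z C)     ∎)
      where
      cw≈0 : chainWeight x z C ≈ 0#
      cw≈0 = trans (*-congʳ (𝟙-no (openChain? x z C) (¬openChain-to-member {C = C} z∈C))) (zeroˡ _)
    ... | no z∉C = trans (reflexive (if-cong (dec-false (z ∈? C) z∉C))) (begin
      𝟙 top′ * (𝟙 oc′ * pow P F w (card C′))               ≈⟨ *-assoc _ _ _ ⟨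
      𝟙 top′ * 𝟙 oc′ * pow P F w (card C′)                 ≈⟨ *-cong (sym (𝟙-∧ top′ oc′)) (reflexive (≡.cong (pow P F w) (card-insert C z z∉C))) ⟩
      𝟙 (top′ ∧ oc′) * (w * pow P F w (card C))            ≈⟨ *-congʳ (reflexive (≡.cong 𝟙 (does-⇔ (insert-top⇔ C z∉C) (isTop? z C′ ×-dec openChain? x y C′) ((x ≺? z ×-dec z ≺? y) ×-dec openChain? x z C)))) ⟩
      𝟙 (btw ∧ oc) * (w * pow P F w (card C))              ≈⟨ *-congʳ (𝟙-∧ btw oc) ⟩
      𝟙 btw * 𝟙 oc * (w * pow P F w (card C))              ≈⟨ solve 4 (λ a b c d → (a ⊕ b) ⊕ (c ⊕ d) ⊜ a ⊕ (c ⊕ (b ⊕ d))) refl (𝟙 btw) (𝟙 oc) w _ ⟩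
      𝟙 btw * (w * (𝟙 oc * pow P F w (card C)))            ∎)
      where
      C′ : Vec Bool n
      C′ = C [ z ]≔ true
      top′ oc′ btw oc : Bool
      top′ = does (isTop? z C′)
      oc′ = does (openChain? x y C′)
      btw = does (x ≺? z ×-dec z ≺? y)
      oc = does (openChain? x z C)

    chainSum-recursion : ∀ x y → chainSum x y ≈ 1# + w * (h ⋆ E) x y
    chainSum-recursion x y = begin
      ∑ₛ n (chainWeight x y)                                   ≈⟨ ∑ₛ-cong n top-decomposition ⟩
      ∑ₛ n (λ C → 𝟙 (does (empty? C)) + sum (λ z → topTerm z C)) ≈⟨ ∑ₛ-distrib n _ _ ⟩
      ∑ₛ n (𝟙 ∘ does ∘ empty?) + ∑ₛ n (λ C → sum (λ z → topTerm z C)) ≈⟨ +-cong ∑ₛ-𝟙-empty (∑ₛ-sum-comm n (λ C z → topTerm z C)) ⟩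
      1# + sum (λ z → ∑ₛ n (topTerm z))                        ≈⟨ +-congˡ (sum-cong-≋ {n} ∑ₛ-topTerm) ⟩
      1# + sum (λ z → w * (h x z * E z y))                     ≈⟨ +-congˡ (*-distribˡ-sum w (λ z → h x z * E z y)) ⟨
      1# + w * (h ⋆ E) x y                                     ∎
      where
      G : Fin n → Vec Bool n → Carrier
      G z C = 𝟙 (does (isTop? z C)) * chainWeight x y C
      topTerm : Fin n → Vec Bool n → Carrier
      topTerm z C = if lookup C z then G z C else 0#
      top-decomposition : ∀ C → chainWeight x y C ≈ 𝟙 (does (empty? C)) + sum (λ z → topTerm z C)
      top-decomposition C = trans (chainWeight-by-top x y C) (+-congˡ (sym (sum-over-tops C (chainWeight x y C))))
      ∑ₛ-topTerm : ∀ z → ∑ₛ n (topTerm z) ≈ w * (h x z * E z y)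
      ∑ₛ-topTerm z = begin
        ∑ₛ n (topTerm z)                                            ≈⟨ ∑ₛ-insert n z (G z) ⟩
        ∑ₛ n (λ C → if lookup C z then 0# else G z (C [ z ]≔ true)) ≈⟨ ∑ₛ-cong n (inserted-term x y z) ⟩
        ∑ₛ n (λ C → 𝟙 btw * (w * chainWeight x z C))                ≈⟨ *-distribˡ-∑ₛ n (𝟙 btw) _ ⟨
        𝟙 btw * ∑ₛ n (λ C → w * chainWeight x z C)                  ≈⟨ *-congˡ (*-distribˡ-∑ₛ n w _) ⟨
        𝟙 btw * (w * chainSum x z)                                  ≈⟨ *-congʳ (𝟙-∧ (does (x ≺? z)) (does (z ≺? y))) ⟩
        𝟙 (does (x ≺? z)) * E z y * (w * chainSum x z)              ≈⟨ rearrange (𝟙 (does (x ≺? z))) (E z y) ⟩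
        w * (𝟙 (does (x ≺? z)) * chainSum x z * E z y)              ≈⟨ *-congˡ (*-congʳ (if≈𝟙* (does (x ≺? z)))) ⟨
        w * (h x z * E z y)                                         ∎
        where
        btw : Bool
        btw = does (x ≺? z ×-dec z ≺? y)
        rearrange : ∀ a b → a * b * (w * chainSum x z) ≈ w * (a * chainSum x z * b)
        rearrange a b = solve 4 (λ a b w v → (a ⊕ b) ⊕ (w ⊕ v) ⊜ w ⊕ ((a ⊕ v) ⊕ b)) refl a b w (chainSum x z)

    ∑ₛ-rankSets : ∀ x y C → let open RankSets x y in
      ∑ₛ m (λ T → pow P F w (card T) * 𝟙 (does (chainWithRanks? T C))) ≈ chainWeight x y C
    ∑ₛ-rankSets x y C = by-cases (openChain? x y C)
      where
      open RankSets x y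
      by-cases : Dec (OpenChain x y C) → ∑ₛ m (λ T → pow P F w (card T) * 𝟙 (does (chainWithRanks? T C))) ≈ chainWeight x y C
      by-cases (yes oc) = begin
        ∑ₛ m (λ T → pow P F w (card T) * 𝟙 (does (chainWithRanks? T C)))
          ≈⟨ ∑ₛ-single m (ranks C) (λ T T≢ranks → trans (*-congˡ (𝟙-no (chainWithRanks? T C) (T≢ranks ∘ chainWithRanks⇒≡ranks {T} {C}))) (zeroʳ _)) ⟩
        pow P F w (card (ranks C)) * 𝟙 (does (chainWithRanks? (ranks C) C))
          ≈⟨ *-cong (reflexive (≡.cong (pow P F w) (card-ranks {C} oc))) (𝟙-yes (chainWithRanks? (ranks C) C) (openChain⇒chainWithRanks {C} oc)) ⟩
        pow P F w (card C) * 1#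
          ≈⟨ *-comm _ _ ⟩
        1# * pow P F w (card C)
          ≈⟨ *-congʳ (𝟙-yes (openChain? x y C) oc) ⟨
        chainWeight x y C ∎
      by-cases (no ¬oc) = begin
        ∑ₛ m (λ T → pow P F w (card T) * 𝟙 (does (chainWithRanks? T C)))
          ≈⟨ ∑ₛ-zero m (λ T → trans (*-congˡ (𝟙-no (chainWithRanks? T C) (¬oc ∘ chainWithRanks⇒openChain {T} {C}))) (zeroʳ _)) ⟩
        0#
          ≈⟨ trans (*-congʳ (𝟙-no (openChain? x y C) ¬oc)) (zeroˡ _) ⟨
        chainWeight x y C ∎

  Lkm≈chainSum : ∀ k x y → Lkm P F k x y (fullSet P F (rk P x y ∸ 1)) ≈ Weighted.chainSum (- ((k + k) ⁻¹)) x y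
  Lkm≈chainSum k x y = begin
    sgn P F (m ∸ card (fullSet P F m)) * sumF P F (allSubsets m) summand
      ≈⟨ *-congʳ (reflexive (≡.cong (sgn P F) (≡.trans (≡.cong (m ∸_) (card-fullSet m)) (ℕ.n∸n≡0 m)))) ⟩
    1# * sumF P F (allSubsets m) summand
      ≈⟨ trans (*-identityˡ _) (sumF-allSubsets m summand) ⟩
    ∑ₛ m summand
      ≈⟨ ∑ₛ-cong m (λ T → reflexive (if-cong (complSub-fullSet m T))) ⟩
    ∑ₛ m (λ T → pow P F w (card T) * ℕ→F P F (flagF P x y T))
      ≈⟨ ∑ₛ-cong m (λ T → *-congˡ (trans (ℕ→F-count _ (allSubsets n)) (sumF-allSubsets n _))) ⟩
    ∑ₛ m (λ T → pow P F w (card T) * ∑ₛ n (λ C → 𝟙 (does (chainWithRanks? T C))))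
      ≈⟨ ∑ₛ-cong m (λ T → *-distribˡ-∑ₛ n _ _) ⟩
    ∑ₛ m (λ T → ∑ₛ n (λ C → pow P F w (card T) * 𝟙 (does (chainWithRanks? T C))))
      ≈⟨ ∑ₛ-comm m n _ ⟩
    ∑ₛ n (λ C → ∑ₛ m (λ T → pow P F w (card T) * 𝟙 (does (chainWithRanks? T C))))
      ≈⟨ ∑ₛ-cong n (∑ₛ-rankSets x y) ⟩
    chainSum x y ∎
    where
    w : Carrier
    w = - ((k + k) ⁻¹)
    open Weighted w
    open RankSets x y
    summand : Vec Bool m → Carrier
    summand T = if complSub P F (fullSet P F m) T then pow P F w (card T) * ℕ→F P F (flagF P x y T) else 0#

  module _ (q : Carrier) where
    open Weighted (- q)
    open import Algebra.Properties.Ring ring using (//-rightDividesˡ; -‿distribˡ-*)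

    h⋆B≐E : h ⋆ (I ⊞ scalar q ⋆ E) ≐ E
    h⋆B≐E x y = trans (⋆-I⊞scalar q h E x y) (by-cases (x ≺? y))
      where
      by-cases : Dec (x ≺ y) → h x y + q * (h ⋆ E) x y ≈ E x y
      by-cases (yes x≺y) = begin
        h x y + q * (h ⋆ E) x y                           ≈⟨ +-congʳ (trans (strict-≺ chainSum x≺y) (chainSum-recursion x y)) ⟩
        1# + - q * (h ⋆ E) x y + q * (h ⋆ E) x y          ≈⟨ +-congʳ (+-congˡ (-‿distribˡ-* q _)) ⟨
        1# - q * (h ⋆ E) x y + q * (h ⋆ E) x y            ≈⟨ //-rightDividesˡ _ _ ⟩
        1#                                                ≈⟨ E-≺ x≺y ⟨
        E x y                                             ∎
      by-cases (no x⊀y) = begin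
        h x y + q * (h ⋆ E) x y   ≈⟨ +-cong (strict-strictlyUpper chainSum x y x⊀y) (*-congˡ (⋆-strictlyUpper (strictlyUpper⇒upper (strict-strictlyUpper chainSum)) E-strictlyUpper x y x⊀y)) ⟩
        0# + q * 0#               ≈⟨ trans (+-identityˡ _) (zeroʳ q) ⟩
        0#                        ≈⟨ E-strictlyUpper x y x⊀y ⟨
        E x y                     ∎

module OrderedFieldFacts {c ℓ ℓ′ : Level} (F : OrderedField c ℓ ℓ′) (k : OrderedField.Carrier F)
                         (0<k : OrderedField._<_ F (OrderedField.0# F) k) where
  open OrderedField F
  open IsStrictTotalOrder isStrictTotalOrder using (irrefl; <-respʳ-≈) renaming (trans to <-trans)
  open import Relation.Binary.Reasoning.Setoid setoid

  q : Carrier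
  q = (k + k) ⁻¹

  k+k≉0 : ¬ (k + k ≈ 0#)
  k+k≉0 k+k≈0 = irrefl (sym k+k≈0) (<-trans (<-respʳ-≈ (sym (+-identityˡ k)) 0<k) (+-mono-< k 0<k))

  [k+k]q≈1 : (k + k) * q ≈ 1#
  [k+k]q≈1 = ⁻¹-inverse (k + k) k+k≉0

  k⁻¹≈q+q : k ⁻¹ ≈ q + q
  k⁻¹≈q+q = begin
    k ⁻¹                      ≈⟨ *-identityʳ _ ⟨
    k ⁻¹ * 1#                 ≈⟨ *-congˡ [k+k]q≈1 ⟨
    k ⁻¹ * ((k + k) * q)      ≈⟨ *-congˡ (trans (distribʳ q k k) (sym (distribˡ k q q))) ⟩
    k ⁻¹ * (k * (q + q))      ≈⟨ *-assoc _ _ _ ⟨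
    k ⁻¹ * k * (q + q)        ≈⟨ *-congʳ (trans (*-comm _ _) (⁻¹-inverse k k≉0)) ⟩
    1# * (q + q)              ≈⟨ *-identityˡ _ ⟩
    q + q                     ∎
    where
    k≉0 : ¬ (k ≈ 0#)
    k≉0 k≈0 = irrefl (sym k≈0) 0<k

  two-cancel : ∀ a → a + a ≈ 0# → a ≈ 0#
  two-cancel a a+a≈0 = begin
    a                   ≈⟨ *-identityˡ a ⟨
    1# * a              ≈⟨ *-congʳ (trans (*-comm _ _) [k+k]q≈1) ⟨
    q * (k + k) * a     ≈⟨ *-assoc _ _ _ ⟩
    q * ((k + k) * a)   ≈⟨ *-congˡ (trans (distribʳ a k k) (sym (distribˡ k a a))) ⟩
    q * (k * (a + a))   ≈⟨ *-congˡ (trans (*-congˡ a+a≈0) (zeroʳ k)) ⟩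
    q * 0#              ≈⟨ zeroʳ q ⟩
    0#                  ∎

parity : ∀ m → 2 ∣ m ⊎ ∃ λ j → m ≡ suc (j ℕ.* 2)
parity zero    = inj₁ (divides 0 ≡.refl)
parity (suc m) with parity m
... | inj₁ (divides j m≡j*2) = inj₂ (j , ≡.cong suc m≡j*2)
... | inj₂ (j , m≡1+j*2)     = inj₁ (divides (suc j) (≡.cong suc m≡1+j*2))

module EvenRanks {c ℓ ℓ′ : Level} (F : OrderedField c ℓ ℓ′) {n : ℕ} (P : GradedPoset n) (k : OrderedField.Carrier F)
                 (0<k : OrderedField._<_ F (OrderedField.0# F) k) where
  open OrderedField F hiding (_<_)
  open OrderedFieldFacts F k 0<k using (two-cancel)
  open GradedPoset P
  open GradedPosetProperties P
  open IncidenceMatrices F P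
  open import Algebra.Properties.Ring ring using (-1*x≈-x)
  open import Relation.Binary.Reasoning.Setoid setoid
  open ChainSums F P
  open Weighted (- ((k + k) ⁻¹))

  L : Fin n → Fin n → Carrier
  L x y = Lkm P F k x y (fullSet P F (rk P x y ∸ 1))

  h≈L : ∀ {x y} → x ≺ y → h x y ≈ L x y
  h≈L {x} {y} x≺y = trans (strict-≺ chainSum x≺y) (sym (Lkm≈chainSum k x y))

  evenRanks⇔antisymmetric : (∀ x y → x ≼ y → 0 < rk P x y → 2 ∣ rk P x y → L x y ≈ 0#) ⇔ h ⊞ conj h ≐ 𝟘
  evenRanks⇔antisymmetric = mk⇔ to from
    where
    to : (∀ x y → x ≼ y → 0 < rk P x y → 2 ∣ rk P x y → L x y ≈ 0#) → h ⊞ conj h ≐ 𝟘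
    to L-even x y with x ≺? y
    ... | no x⊀y = trans (+-cong (strict-strictlyUpper chainSum x y x⊀y) (conj-strictlyUpper (strict-strictlyUpper chainSum) x y x⊀y)) (+-identityʳ 0#)
    ... | yes x≺y@(x≼y , _) = trans (+-congˡ (conj-≼ h x≼y)) (by-parity (parity (rk P x y)))
      where
      by-parity : 2 ∣ rk P x y ⊎ ∃ (λ j → rk P x y ≡ suc (j ℕ.* 2)) → h x y + sgn P F (rk P x y) * h x y ≈ 0#
      by-parity (inj₁ even) = begin
        h x y + sgn P F (rk P x y) * h x y  ≈⟨ +-cong h≈0 (*-congˡ h≈0) ⟩
        0# + sgn P F (rk P x y) * 0#        ≈⟨ trans (+-identityˡ _) (zeroʳ _) ⟩
        0#                                  ∎
        where
        h≈0 : h x y ≈ 0#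
        h≈0 = trans (h≈L x≺y) (L-even x y x≼y (rk-pos x≺y) even)
      by-parity (inj₂ (j , rk≡)) = begin
        h x y + sgn P F (rk P x y) * h x y  ≈⟨ +-congˡ (*-congʳ (trans (reflexive (≡.cong (sgn P F) rk≡)) (-‿cong (sgn-even j)))) ⟩
        h x y + - 1# * h x y                ≈⟨ +-congˡ (-1*x≈-x _) ⟩
        h x y - h x y                       ≈⟨ -‿inverseʳ _ ⟩
        0#                                  ∎
    from : h ⊞ conj h ≐ 𝟘 → ∀ x y → x ≼ y → 0 < rk P x y → 2 ∣ rk P x y → L x y ≈ 0#
    from antisym x y x≼y 0<rk (divides j rk≡) = trans (sym (h≈L x≺y)) (two-cancel (h x y) (begin
      h x y + h x y                        ≈⟨ +-congˡ (*-identityˡ _) ⟨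
      h x y + 1# * h x y                   ≈⟨ +-congˡ (*-congʳ (trans (reflexive (≡.cong (sgn P F) rk≡)) (sgn-even j))) ⟨
      h x y + sgn P F (rk P x y) * h x y   ≈⟨ +-congˡ (conj-≼ h x≼y) ⟨
      h x y + conj h x y                   ≈⟨ antisym x y ⟩
      0#                                   ∎))
      where
      x≺y : x ≺ y
      x≺y = rk-pos⇒≺ x≼y 0<rk

mainTheorem9 : {c ℓ ℓ' : Level} (F : OrderedField c ℓ ℓ') (k : OrderedField.Carrier F) →
    OrderedField._<_ F (OrderedField.0# F) k →
    {n : ℕ} (P : GradedPoset n) →
    IsKEulerian P F k ⇔
      (∀ x y → GradedPoset._≼_ P x y → 0 < rk P x y → 2 ∣ rk P x y →
        OrderedField._≈_ F (Lkm P F k x y (fullSet P F (rk P x y ∸ 1))) (OrderedField.0# F))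
mainTheorem9 F k 0<k P =
  isKEulerian⇔ν≐conjE                                  ⟨ ⇔.trans ⟩
  σ-fixed⇔Y≈0 D-cancellable (ν⋆D≐⊟E q k⁻¹≈q+q)         ⟨ ⇔.trans ⟩
  ⇔.sym (σ-antisymmetric⇔Y≈0 B-cancellable (h⋆B≐E q))  ⟨ ⇔.trans ⟩
  ⇔.sym evenRanks⇔antisymmetric
  where
  open OrderedFieldFacts F k 0<k
  open IncidenceMatrices F P
  open KMöbius F P k
  open ChainSums F P using (h⋆B≐E)
  open EvenRanks F P k 0<k using (evenRanks⇔antisymmetric)
  open Reciprocity matrixRing
  open WithEndomorphism conj conj-cong conj-⊞ conj-⋆ conj-I (scalar q) E (scalar-central q) (conj-scalar q)
  B-cancellable : RightCancellable B
  B-cancellable = I⊞strictlyUpper-cancellable (⋆-strictlyUpper (scalar-upper q) E-strictlyUpper)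
  D-cancellable : RightCancellable D
  D-cancellable = I⊞strictlyUpper-cancellable (⋆-strictlyUpper (⊞-upper (scalar-upper q) (scalar-upper q)) E-strictlyUpper)
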